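{- Let $\mathbf{x}\in\mathbb{Z}^{nt}$ be a feasible solution of the combinatorial $n$-fold IP and $\alpha\in\mathbb{N}$. Then every $\mathbf{g}\in\mathcal{G}(E^{(n)})$ with $\mathbf{l}\le\mathbf{x}+\alpha\mathbf{g}\le\mathbf{u}$ is a solution of the augmentation graph $DP(\mathbf{x},\alpha)$.
   Context: Combinatorial $n$-fold IP: $\min\{f(\mathbf{x})\mid E^{(n)}\mathbf{x}=\mathbf{b},\ \mathbf{l}\le\mathbf{x}\le\mathbf{u},\ \mathbf{x}\in\mathbb{Z}^{nt}\}$, where $D\in\mathbb{Z}^{r\times t}$, $E^{(n)}$ has top rows $(D~\cdots~D)$ ($n$ copies) and below them the block-diagonal matrix with $n$ blocks $\mathbf{1}^{\intercal}=(1~\cdots~1)\in\mathbb{Z}^{1\times t}$, and $f$ is separable convex; $\mathbf{x}$ is split into bricks $\mathbf{x}^1,\dots,\mathbf{x}^n\in\mathbb{Z}^t$, and $D_j$ is the $j$-th column of $D$. The Graver basis $\mathcal{G}(M)$ of an integer matrix $M$ is the set of nonzero integer vectors $\mathbf{z}$ with $M\mathbf{z}=\mathbf{0}$ that are minimal in the conformal order ($\mathbf{y}\sqsubseteq\mathbf{x}$ iff same orthant and $|y_i|\le|x_i|$ for all $i$). Let $\Delta=1+\|D\|_\infty$, $g(E)=\max\{\|\mathbf{v}\|_1\mid\mathbf{v}\in\mathcal{G}(DG)\}$ where $G$ has as columns the elements of $\mathcal{G}(\mathbf{1}^{\intercal})$, and $\Sigma(E)=[-2\Delta g(E),2\Delta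 g(E)]^r\cap\mathbb{Z}^r$. The augmentation graph $DP(\mathbf{x},\alpha)$ has source $S$, sink $T$ and layers $\mathcal{L}(i,j)=\{(i,j)\}\times[-g(E),g(E)]\times[-g(E),g(E)]\times\Sigma(E)$ ($i\in[n]$, $j\in[t]$). Edges: (a) for $j<t$, from $(i,j,h^i_j,\beta^i_j,\boldsymbol{\sigma}^i_j)$ to $(i,j+1,h^i_{j+1},\beta^i_{j+1},\boldsymbol{\sigma}^i_{j+1})$ whenever $l^i_{j+1}\le x^i_{j+1}+\alpha h^i_{j+1}\le u^i_{j+1}$, $\beta^i_{j+1}=\beta^i_j+h^i_{j+1}$, $\boldsymbol{\sigma}^i_{j+1}=\boldsymbol{\sigma}^i_j+D_{j+1}h^i_{j+1}$; (b) from each $(i,t,h^i_t,0,\boldsymbol{\sigma}^i_t)$ to each $(i+1,1,h^{i+1}_1,h^{i+1}_1,\boldsymbol{\sigma}^{i+1}_1)$ with $l^{i+1}_1\le x^{i+1}_1+\alpha h^{i+1}_1\le u^{i+1}_1$ and $\boldsymbol{\sigma}^{i+1}_1=\boldsymbol{\sigma}^i_t+D_1h^{i+1}_1$; here $S=(0,t,0,0,\mathbf{0})$ acts as the last vertex of a brick $0$ and $T=(n+1,1,0,0,\mathbf{0})$ is entered exactly from vertices $(n,t,h,0,\mathbf{0})$. A vector $\mathbf{h}\in\mathbb{Z}^{nt}$ is a solution of $DP(\mathbf{x},\alpha)$ if it consists of the $h^i_j$-coordinates of the vertices of some $S$–$T$ path. -}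

module Defs where

open import Data.Nat as ℕ using (ℕ; zero; suc)
open import Data.Integer using (ℤ; +_; _+_; _*_; -_; ∣_∣; _≤_; 0ℤ; 1ℤ)
open import Data.Fin using (Fin; zero; suc; toℕ; splitAt)
open import Data.Fin.Properties using (_≟_)
open import Data.Product using (Σ; ∃; ∃₂; _×_; _,_)
open import Data.Sum using (_⊎_; inj₁; inj₂)
open import Data.Unit using (⊤)
open import Relation.Nullary using (yes; no)
open import Relation.Binary.PropositionalEquality using (_≡_; _≢_)

sumFin : ∀ {k} → (Fin k → ℤ) → ℤ
sumFin {zero}  f = 0ℤ
sumFin {suc k} f = f zero + sumFin (λ i → f (suc i))

sumFinℕ : ∀ {k} → (Fin k → ℕ) → ℕ
sumFinℕ {zero}  f = 0
sumFinℕ {suc k} f = f zero ℕ.+ sumFinℕ (λ i → f (suc i))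

maxFin : ∀ {k} → (Fin k → ℕ) → ℕ
maxFin {zero}  f = 0
maxFin {suc k} f = f zero ℕ.⊔ maxFin (λ i → f (suc i))

NonZeroVec : {I : Set} → (I → ℤ) → Set
NonZeroVec {I} z = Σ I λ i → z i ≢ 0ℤ

_⊑_ : {I : Set} → (I → ℤ) → (I → ℤ) → Set
y ⊑ x = ∀ i → (0ℤ ≤ y i * x i) × (∣ y i ∣ ℕ.≤ ∣ x i ∣)

IsGraverElement : {I : Set} → ((I → ℤ) → Set) → (I → ℤ) → Set
IsGraverElement Ker z =
  NonZeroVec z × Ker z ×
  (∀ y → NonZeroVec y → Ker y → y ⊑ z → ∀ i → y i ≡ z i)

MatKer : ∀ {p q} → (Fin p → Fin q → ℤ) → (Fin q → ℤ) → Set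
MatKer A z = ∀ k → sumFin (λ j → A k j * z j) ≡ 0ℤ

Graver : ∀ {p q} → (Fin p → Fin q → ℤ) → (Fin q → ℤ) → Set
Graver A = IsGraverElement (MatKer A)

ones : ∀ {t} → Fin 1 → Fin t → ℤ
ones _ _ = 1ℤ

-- cols c is the c-th column of G; the columns enumerate 𝒢(1ᵀ)
-- exactly once each.
IsGraverColumns : ∀ {t m} → (Fin m → Fin t → ℤ) → Set
IsGraverColumns {t} {m} cols =
  (∀ c → Graver (ones {t}) (cols c)) ×
  (∀ c c' → (∀ j → cols c j ≡ cols c' j) → c ≡ c') ×
  (∀ z → Graver (ones {t}) z → Σ (Fin m) λ c → ∀ j → cols c j ≡ z j)

DG : ∀ {r t m} → (Fin r → Fin t → ℤ) → (Fin m → Fin t → ℤ) → Fin r → Fin m → ℤ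
DG D cols k c = sumFin (λ j → D k j * cols c j)

norm1 : ∀ {m} → (Fin m → ℤ) → ℕ
norm1 v = sumFinℕ (λ c → ∣ v c ∣)

-- gE = g(E) = max { ‖v‖₁ | v ∈ 𝒢(DG) }  (max ∅ = 0)
IsGE : ∀ {r t m} → (Fin r → Fin t → ℤ) → (Fin m → Fin t → ℤ) → ℕ → Set
IsGE {m = m} D cols gE =
  (∀ v → Graver (DG D cols) v → norm1 v ℕ.≤ gE) ×
  (gE ≡ 0 ⊎ Σ (Fin m → ℤ) λ v → Graver (DG D cols) v × norm1 v ≡ gE)

-- The n-fold matrix E⁽ⁿ⁾ ; vectors in ℤ^{nt} are indexed by (brick i, coordinate j)

En : ∀ {r t n} → (Fin r → Fin t → ℤ) → Fin (r ℕ.+ n) → Fin n × Fin t → ℤ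
En {r} D k (i , j) with splitAt r k
... | inj₁ k' = D k' j
... | inj₂ i' with i' ≟ i
...   | yes _ = 1ℤ
...   | no  _ = 0ℤ

applyEn : ∀ {r t n} → (Fin r → Fin t → ℤ) → (Fin n × Fin t → ℤ) → Fin (r ℕ.+ n) → ℤ
applyEn D z k = sumFin (λ i → sumFin (λ j → En D k (i , j) * z (i , j)))

KerEn : ∀ {r t n} → (Fin r → Fin t → ℤ) → (Fin n × Fin t → ℤ) → Set
KerEn D z = ∀ k → applyEn D z k ≡ 0ℤ

Feasible : ∀ {r t n} → (Fin r → Fin t → ℤ) → (Fin (r ℕ.+ n) → ℤ) →
           (l u x : Fin n × Fin t → ℤ) → Set
Feasible D b l u x = (∀ k → applyEn D x k ≡ b k) × (∀ p → l p ≤ x p × x p ≤ u p)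

-- The augmentation graph DP(x, α)   (bricks i and coordinates j are 0-based)

module AugGraph {n t r : ℕ} (D : Fin r → Fin t → ℤ) (l u x : Fin n × Fin t → ℤ)
                (α : ℕ) (gE : ℕ) where

  Δ : ℕ
  Δ = suc (maxFin (λ k → maxFin (λ j → ∣ D k j ∣)))

  InRange : ℤ → ℤ → Set
  InRange bd v = (- bd ≤ v) × (v ≤ bd)

  data Vtx : Set where
    S T  : Vtx
    node : Fin n → Fin t → (h β : ℤ) → (σ : Fin r → ℤ) → Vtx

  InGraph : Vtx → Set
  InGraph S = ⊤
  InGraph T = ⊤
  InGraph (node i j h β σ) =
    InRange (+ gE) h × InRange (+ gE) β × (∀ k → InRange (+ (2 ℕ.* Δ ℕ.* gE)) (σ k))

  BoundOK : Fin n → Fin t → ℤ → Set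
  BoundOK i j h = (l (i , j) ≤ x (i , j) + + α * h) × (x (i , j) + + α * h ≤ u (i , j))

  data Edge : Vtx → Vtx → Set where
    edge-a : ∀ {i j j' h β σ h' β' σ'} →
      suc (toℕ j) ≡ toℕ j' →
      InGraph (node i j h β σ) → InGraph (node i j' h' β' σ') →
      BoundOK i j' h' → β' ≡ β + h' → (∀ k → σ' k ≡ σ k + D k j' * h') →
      Edge (node i j h β σ) (node i j' h' β' σ')
    edge-b : ∀ {i i' j j' h σ h' σ'} →
      suc (toℕ j) ≡ t → suc (toℕ i) ≡ toℕ i' → toℕ j' ≡ 0 →
      InGraph (node i j h 0ℤ σ) → InGraph (node i' j' h' h' σ') →
      BoundOK i' j' h' → (∀ k → σ' k ≡ σ k + D k j' * h') →
      Edge (node i j h 0ℤ σ) (node i' j' h' h' σ')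
    -- (b) with S = (0, t, 0, 0, 0) as last vertex of brick 0
    edge-S : ∀ {i' j' h' σ'} →
      toℕ i' ≡ 0 → toℕ j' ≡ 0 →
      InGraph (node i' j' h' h' σ') →
      BoundOK i' j' h' → (∀ k → σ' k ≡ 0ℤ + D k j' * h') →
      Edge S (node i' j' h' h' σ')
    edge-T : ∀ {i j h σ} →
      suc (toℕ i) ≡ n → suc (toℕ j) ≡ t → (∀ k → σ k ≡ 0ℤ) →
      InGraph (node i j h 0ℤ σ) →
      Edge (node i j h 0ℤ σ) T
    -- degenerate case n = 0: S itself is the vertex (n, t, 0, 0, 0)
    edge-ST : n ≡ 0 → Edge S T

  data Walk : Vtx → Vtx → Set where
    []  : ∀ {v} → Walk v v
    _∷_ : ∀ {a b c} → Edge a b → Walk b c → Walk a c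

  data Visits (P : Vtx → Set) : ∀ {a c} → Walk a c → Set where
    here  : ∀ {a c} {w : Walk a c} → P a → Visits P w
    there : ∀ {a b c} {e : Edge a b} {w : Walk b c} → Visits P w → Visits P (e ∷ w)

  IsSolution : (Fin n × Fin t → ℤ) → Set
  IsSolution hv =
    Σ (Walk S T) λ w →
      ∀ i j → Visits (λ v → ∃₂ λ β σ → v ≡ node i j (hv (i , j)) β σ) w

module Submission where

-- Every brick gᵢ of g sums to zero, so it is a conformal sum of columns eₐ - e_b of G with
-- weights Wᵢ ≥ 0 and ‖gᵢ‖₁ = 2 ∑ Wᵢ. The total weight Λ = ∑ᵢ Wᵢ lies in 𝒢(DG): a nonzero
-- y ⊑ Λ in the kernel of DG splits into brick weights Yᵢ ≤ Wᵢ, and (G Yᵢ)ᵢ is then a nonzero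
-- element of ker E⁽ⁿ⁾ conformal to g, hence equal to g by minimality; this forces Y = W and
-- y = Λ. Therefore ‖g‖₁ = 2‖Λ‖₁ ≤ 2 g(E). Since each brick sums to zero, each entry and each
-- partial sum of a brick is at most half its ℓ₁-norm, hence at most g(E), and the partial sums
-- of D g are at most Δ‖g‖₁ ≤ 2Δ g(E). So the vertices (i, j, gᵢⱼ, ∑_{j′≤j} gᵢⱼ′, partial sum
-- of D g up to (i, j)), visited brick by brick, form an S–T path of DP(x, α).

open import Defs
open import Algebra.Bundles using (AbelianGroup)
import Algebra.Properties.CommutativeMonoid.Sum as CommutativeMonoidSum
import Algebra.Properties.Group as GroupProperties
import Algebra.Properties.Semiring.Sum as SemiringSum
open import Data.Empty using (⊥-elim)
open import Data.Fin as Fin using (Fin; zero; suc; toℕ; fromℕ<; splitAt; _↑ˡ_; _↑ʳ_)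
import Data.Fin.Properties as Fin
open import Data.Integer as ℤ using (ℤ; 0ℤ)
import Data.Integer.Properties as ℤ
open import Data.Integer.Tactic.RingSolver using (solve-∀)
open import Data.Nat as ℕ using (ℕ; zero; suc; z≤n; s≤s; _⊓_; _∸_; _≤′_; ≤′-refl; ≤′-step)
import Data.Nat.Properties as ℕ
import Data.Nat.Tactic.RingSolver as ℕ-Solver
open import Data.Product using (Σ; ∃; ∃₂; _×_; _,_; proj₁; proj₂)
open import Data.Sum using (_⊎_; inj₁; inj₂)
open import Function using (_∘_)
open import Relation.Binary.PropositionalEquality
open import Relation.Nullary using (yes; no; ¬_)

module FiniteSums where

  open import Data.Vec.Functional using (_∷_)
  open import Data.Integer using (ℤ; +_; 0ℤ; -1ℤ; _+_; _*_; -_; _≤_)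

  private
    module ∑ℤ = CommutativeMonoidSum ℤ.+-0-commutativeMonoid
    module ∑ℕ = CommutativeMonoidSum ℕ.+-0-commutativeMonoid
    module ∑ℤ* = SemiringSum ℤ.+-*-semiring
    module ∑ℕ* = SemiringSum ℕ.+-*-semiring

  sumFin≡∑ : ∀ {k} (f : Fin k → ℤ) → sumFin f ≡ ∑ℤ.sum f
  sumFin≡∑ {zero}  f = refl
  sumFin≡∑ {suc k} f = cong (_+_ (f zero)) (sumFin≡∑ (f ∘ suc))

  sumFinℕ≡∑ : ∀ {k} (f : Fin k → ℕ) → sumFinℕ f ≡ ∑ℕ.sum f
  sumFinℕ≡∑ {zero}  f = refl
  sumFinℕ≡∑ {suc k} f = cong (f zero ℕ.+_) (sumFinℕ≡∑ (f ∘ suc))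

  sumFin-cong : ∀ {k} {f g : Fin k → ℤ} → (∀ i → f i ≡ g i) → sumFin f ≡ sumFin g
  sumFin-cong {f = f} {g} f≗g =
    trans (sumFin≡∑ f) (trans (∑ℤ.sum-cong-≗ f≗g) (sym (sumFin≡∑ g)))

  sumFin-zero : ∀ k → sumFin {k} (λ _ → 0ℤ) ≡ 0ℤ
  sumFin-zero k = trans (sumFin≡∑ (λ (_ : Fin k) → 0ℤ)) (∑ℤ.sum-replicate-zero k)

  sumFin-distrib-+ : ∀ {k} (f g : Fin k → ℤ) →
                     sumFin (λ i → f i + g i) ≡ sumFin f + sumFin g
  sumFin-distrib-+ f g = begin
    sumFin (λ i → f i + g i)  ≡⟨ sumFin≡∑ (λ i → f i + g i) ⟩
    ∑ℤ.sum (λ i → f i + g i)  ≡⟨ ∑ℤ.∑-distrib-+ f g ⟩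
    ∑ℤ.sum f + ∑ℤ.sum g       ≡⟨ cong₂ _+_ (sumFin≡∑ f) (sumFin≡∑ g) ⟨
    sumFin f + sumFin g       ∎
    where open ≡-Reasoning

  sumFin-*ˡ : ∀ {k} a (f : Fin k → ℤ) → sumFin (λ i → a * f i) ≡ a * sumFin f
  sumFin-*ˡ a f = begin
    sumFin (λ i → a * f i)  ≡⟨ sumFin≡∑ (λ i → a * f i) ⟩
    ∑ℤ.sum (λ i → a * f i)  ≡⟨ ∑ℤ*.*-distribˡ-sum a f ⟨
    a * ∑ℤ.sum f            ≡⟨ cong (a *_) (sumFin≡∑ f) ⟨
    a * sumFin f            ∎
    where open ≡-Reasoning

  sumFin-*ʳ : ∀ {k} a (f : Fin k → ℤ) → sumFin (λ i → f i * a) ≡ sumFin f * a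
  sumFin-*ʳ a f = begin
    sumFin (λ i → f i * a)  ≡⟨ sumFin-cong (λ i → ℤ.*-comm (f i) a) ⟩
    sumFin (λ i → a * f i)  ≡⟨ sumFin-*ˡ a f ⟩
    a * sumFin f            ≡⟨ ℤ.*-comm a (sumFin f) ⟩
    sumFin f * a            ∎
    where open ≡-Reasoning

  sumFin-neg : ∀ {k} (f : Fin k → ℤ) → sumFin (λ i → - f i) ≡ - sumFin f
  sumFin-neg f = begin
    sumFin (λ i → - f i)     ≡⟨ sumFin-cong (λ i → ℤ.-1*i≡-i (f i)) ⟨
    sumFin (λ i → -1ℤ * f i) ≡⟨ sumFin-*ˡ -1ℤ f ⟩
    -1ℤ * sumFin f           ≡⟨ ℤ.-1*i≡-i (sumFin f) ⟩
    - sumFin f               ∎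
    where open ≡-Reasoning

  sumFin-comm : ∀ {k l} (F : Fin k → Fin l → ℤ) →
                sumFin (λ i → sumFin (F i)) ≡ sumFin (λ j → sumFin (λ i → F i j))
  sumFin-comm F = begin
    sumFin (λ i → sumFin (F i))                ≡⟨ sumFin-cong (λ i → sumFin≡∑ (F i)) ⟩
    sumFin (λ i → ∑ℤ.sum (F i))                ≡⟨ sumFin≡∑ (λ i → ∑ℤ.sum (F i)) ⟩
    ∑ℤ.sum (λ i → ∑ℤ.sum (F i))                ≡⟨ ∑ℤ.∑-comm F ⟩
    ∑ℤ.sum (λ j → ∑ℤ.sum (λ i → F i j))        ≡⟨ sumFin≡∑ (λ j → ∑ℤ.sum (λ i → F i j)) ⟨
    sumFin (λ j → ∑ℤ.sum (λ i → F i j))        ≡⟨ sumFin-cong (λ j → sumFin≡∑ (λ i → F i j)) ⟨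
    sumFin (λ j → sumFin (λ i → F i j))        ∎
    where open ≡-Reasoning

  sumFin-mono-≤ : ∀ {k} {f g : Fin k → ℤ} → (∀ i → f i ≤ g i) → sumFin f ≤ sumFin g
  sumFin-mono-≤ {zero}  f≤g = ℤ.≤-refl
  sumFin-mono-≤ {suc k} f≤g = ℤ.+-mono-≤ (f≤g zero) (sumFin-mono-≤ (f≤g ∘ suc))

  sumFin-nonNeg : ∀ {k} {f : Fin k → ℤ} → (∀ i → 0ℤ ≤ f i) → 0ℤ ≤ sumFin f
  sumFin-nonNeg {k} {f} 0≤f = subst (_≤ sumFin f) (sumFin-zero k) (sumFin-mono-≤ 0≤f)

  term≤sumFin : ∀ {k} {f : Fin k → ℤ} → (∀ i → 0ℤ ≤ f i) → ∀ i → f i ≤ sumFin f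
  term≤sumFin {suc k} {f} 0≤f zero =
    subst (_≤ sumFin f) (ℤ.+-identityʳ (f zero)) (ℤ.+-monoʳ-≤ (f zero) (sumFin-nonNeg (0≤f ∘ suc)))
  term≤sumFin {suc k} {f} 0≤f (suc i) =
    subst (_≤ sumFin f) (ℤ.+-identityˡ (f (suc i))) (ℤ.+-mono-≤ (0≤f zero) (term≤sumFin (0≤f ∘ suc) i))

  sumFin-nonNeg-≡0 : ∀ {k} {f : Fin k → ℤ} → (∀ i → 0ℤ ≤ f i) → sumFin f ≡ 0ℤ → ∀ i → f i ≡ 0ℤ
  sumFin-nonNeg-≡0 0≤f ∑f≡0 i = ℤ.≤-antisym (subst (_ ≤_) ∑f≡0 (term≤sumFin 0≤f i)) (0≤f i)

  sumFinℕ-cong : ∀ {k} {f g : Fin k → ℕ} → (∀ i → f i ≡ g i) → sumFinℕ f ≡ sumFinℕ g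
  sumFinℕ-cong {f = f} {g} f≗g =
    trans (sumFinℕ≡∑ f) (trans (∑ℕ.sum-cong-≗ f≗g) (sym (sumFinℕ≡∑ g)))

  sumFinℕ-*ˡ : ∀ {k} a (f : Fin k → ℕ) → sumFinℕ (λ i → a ℕ.* f i) ≡ a ℕ.* sumFinℕ f
  sumFinℕ-*ˡ a f = begin
    sumFinℕ (λ i → a ℕ.* f i)  ≡⟨ sumFinℕ≡∑ (λ i → a ℕ.* f i) ⟩
    ∑ℕ.sum (λ i → a ℕ.* f i)   ≡⟨ ∑ℕ*.*-distribˡ-sum a f ⟨
    a ℕ.* ∑ℕ.sum f             ≡⟨ cong (a ℕ.*_) (sumFinℕ≡∑ f) ⟨
    a ℕ.* sumFinℕ f            ∎
    where open ≡-Reasoning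

  sumFinℕ-comm : ∀ {k l} (F : Fin k → Fin l → ℕ) →
                 sumFinℕ (λ i → sumFinℕ (F i)) ≡ sumFinℕ (λ j → sumFinℕ (λ i → F i j))
  sumFinℕ-comm F = begin
    sumFinℕ (λ i → sumFinℕ (F i))              ≡⟨ sumFinℕ-cong (λ i → sumFinℕ≡∑ (F i)) ⟩
    sumFinℕ (λ i → ∑ℕ.sum (F i))               ≡⟨ sumFinℕ≡∑ (λ i → ∑ℕ.sum (F i)) ⟩
    ∑ℕ.sum (λ i → ∑ℕ.sum (F i))                ≡⟨ ∑ℕ.∑-comm F ⟩
    ∑ℕ.sum (λ j → ∑ℕ.sum (λ i → F i j))        ≡⟨ sumFinℕ≡∑ (λ j → ∑ℕ.sum (λ i → F i j)) ⟨
    sumFinℕ (λ j → ∑ℕ.sum (λ i → F i j))       ≡⟨ sumFinℕ-cong (λ j → sumFinℕ≡∑ (λ i → F i j)) ⟨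
    sumFinℕ (λ j → sumFinℕ (λ i → F i j))      ∎
    where open ≡-Reasoning

  term≤sumFinℕ : ∀ {k} (f : Fin k → ℕ) i → f i ℕ.≤ sumFinℕ f
  term≤sumFinℕ f zero    = ℕ.m≤m+n (f zero) _
  term≤sumFinℕ f (suc i) = ℕ.≤-trans (term≤sumFinℕ (f ∘ suc) i) (ℕ.m≤n+m _ (f zero))

  +-sumFinℕ : ∀ {k} (f : Fin k → ℕ) → + sumFinℕ f ≡ sumFin (λ i → + f i)
  +-sumFinℕ {zero}  f = refl
  +-sumFinℕ {suc k} f = trans (ℤ.pos-+ (f zero) _) (cong (_+_ (+ f zero)) (+-sumFinℕ (f ∘ suc)))

  sumFinℕ-distrib-+ : ∀ {k} (f g : Fin k → ℕ) →
                      sumFinℕ (λ i → f i ℕ.+ g i) ≡ sumFinℕ f ℕ.+ sumFinℕ g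
  sumFinℕ-distrib-+ f g = begin
    sumFinℕ (λ i → f i ℕ.+ g i)  ≡⟨ sumFinℕ≡∑ (λ i → f i ℕ.+ g i) ⟩
    ∑ℕ.sum (λ i → f i ℕ.+ g i)   ≡⟨ ∑ℕ.∑-distrib-+ f g ⟩
    ∑ℕ.sum f ℕ.+ ∑ℕ.sum g        ≡⟨ cong₂ ℕ._+_ (sumFinℕ≡∑ f) (sumFinℕ≡∑ g) ⟨
    sumFinℕ f ℕ.+ sumFinℕ g      ∎
    where open ≡-Reasoning

  sumFinℕ-zero : ∀ k → sumFinℕ {k} (λ _ → 0) ≡ 0
  sumFinℕ-zero k = trans (sumFinℕ≡∑ (λ (_ : Fin k) → 0)) (∑ℕ.sum-replicate-zero k)

  maxFin-≥ : ∀ {k} (f : Fin k → ℕ) i → f i ℕ.≤ maxFin f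
  maxFin-≥ f zero    = ℕ.m≤m⊔n (f zero) _
  maxFin-≥ f (suc i) = ℕ.≤-trans (maxFin-≥ (f ∘ suc) i) (ℕ.m≤n⊔m (f zero) _)

  ∃-positive-term : ∀ {k} (f : Fin k → ℕ) → ¬ (∀ i → f i ≡ 0) → ∃ λ i → 0 ℕ.< f i
  ∃-positive-term {k} f f≢0 =
    let i , fi≢0 = Fin.¬∀⟶∃¬ k (λ i → f i ≡ 0) (λ i → f i ℕ.≟ 0) f≢0 in i , ℕ.n≢0⇒n>0 fi≢0

  split-≤-sumFinℕ : ∀ {n} (w : Fin n → ℕ) {k} → k ℕ.≤ sumFinℕ w →
                    ∃ λ u → (∀ i → u i ℕ.≤ w i) × sumFinℕ u ≡ k
  split-≤-sumFinℕ {zero}  w k≤0 = (λ ()) , (λ ()) , sym (ℕ.n≤0⇒n≡0 k≤0)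
  split-≤-sumFinℕ {suc n} w {k} k≤∑w =
    let u , u≤w , ∑u≡k∸w₀ = split-≤-sumFinℕ (w ∘ suc) (ℕ.m≤n+o⇒m∸n≤o k (w zero) k≤∑w)
    in  (w zero ⊓ k) ∷ u ,
        (λ { zero → ℕ.m⊓n≤m (w zero) k ; (suc i) → u≤w i }) ,
        trans (cong (w zero ⊓ k ℕ.+_) ∑u≡k∸w₀) (ℕ.m⊓n+n∸m≡n (w zero) k)

module ConformalOrder where

  open import Data.Integer using (ℤ; +_; -[1+_]; 0ℤ; 1ℤ; _+_; _*_; -_; _-_; ∣_∣; _≤_; +≤+; -≤+; -≤-)
  open FiniteSums

  -- The conformal order on one coordinate, phrased as: x lies between 0 and y. It is equivalent
  -- to the coordinate condition of _⊑_ (⊑ᶻ⇒⊑-coordinate, ⊑-coordinate⇒⊑ᶻ) but easier to use.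
  infix 4 _⊑ᶻ_
  _⊑ᶻ_ : ℤ → ℤ → Set
  x ⊑ᶻ y = (0ℤ ≤ y → 0ℤ ≤ x × x ≤ y) × (y ≤ 0ℤ → y ≤ x × x ≤ 0ℤ)

  0⊑ᶻ : ∀ y → 0ℤ ⊑ᶻ y
  0⊑ᶻ y = (λ 0≤y → ℤ.≤-refl , 0≤y) , (λ y≤0 → y≤0 , ℤ.≤-refl)

  ⊑ᶻ-trans : ∀ {x y z} → x ⊑ᶻ y → y ⊑ᶻ z → x ⊑ᶻ z
  ⊑ᶻ-trans (x⁺ , x⁻) (y⁺ , y⁻) =
    (λ 0≤z → let 0≤y , y≤z = y⁺ 0≤z ; 0≤x , x≤y = x⁺ 0≤y in 0≤x , ℤ.≤-trans x≤y y≤z) ,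
    (λ z≤0 → let z≤y , y≤0 = y⁻ z≤0 ; y≤x , x≤0 = x⁻ y≤0 in ℤ.≤-trans z≤y y≤x , x≤0)

  neg-⊑ᶻ : ∀ {x y} → x ⊑ᶻ y → - x ⊑ᶻ - y
  neg-⊑ᶻ {x} {y} (x⁺ , x⁻) =
    (λ 0≤-y → let y≤x , x≤0 = x⁻ (ℤ.neg-cancel-≤ 0≤-y) in ℤ.neg-mono-≤ x≤0 , ℤ.neg-mono-≤ y≤x) ,
    (λ -y≤0 → let 0≤x , x≤y = x⁺ (ℤ.neg-cancel-≤ -y≤0) in ℤ.neg-mono-≤ x≤y , ℤ.neg-mono-≤ 0≤x)

  ⊑ᶻ⇒⊑-coordinate : ∀ {x y} → x ⊑ᶻ y → (0ℤ ≤ x * y) × (∣ x ∣ ℕ.≤ ∣ y ∣)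
  ⊑ᶻ⇒⊑-coordinate {+ m} {+ n} (x⁺ , _) =
    subst (0ℤ ≤_) (ℤ.pos-* m n) (+≤+ z≤n) , ℤ.drop‿+≤+ (proj₂ (x⁺ (+≤+ z≤n)))
  ⊑ᶻ⇒⊑-coordinate {+ zero}  { -[1+ n ]} _ = +≤+ z≤n , z≤n
  ⊑ᶻ⇒⊑-coordinate {+ suc m} { -[1+ n ]} (_ , x⁻) with x⁻ -≤+
  ... | _ , +≤+ ()
  ⊑ᶻ⇒⊑-coordinate { -[1+ m ]} {+ n} (x⁺ , _) with x⁺ (+≤+ z≤n)
  ... | () , _
  ⊑ᶻ⇒⊑-coordinate { -[1+ m ]} { -[1+ n ]} (_ , x⁻) with x⁻ -≤+
  ... | -≤- n≤m , _ = +≤+ z≤n , s≤s n≤m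

  ⊑-coordinate⇒⊑ᶻ : ∀ {x y} → 0ℤ ≤ x * y → ∣ x ∣ ℕ.≤ ∣ y ∣ → x ⊑ᶻ y
  ⊑-coordinate⇒⊑ᶻ {+ m} {+ n} _ m≤n = (λ _ → +≤+ z≤n , +≤+ m≤n) , λ { (+≤+ z≤n) → lem m≤n }
    where
    lem : m ℕ.≤ 0 → 0ℤ ≤ + m × + m ≤ 0ℤ
    lem z≤n = +≤+ z≤n , +≤+ z≤n
  ⊑-coordinate⇒⊑ᶻ {+ zero}  { -[1+ n ]} _ _ = (λ ()) , λ _ → -≤+ , +≤+ z≤n
  ⊑-coordinate⇒⊑ᶻ { -[1+ m ]} {+ zero}  _ ()
  ⊑-coordinate⇒⊑ᶻ { -[1+ m ]} { -[1+ n ]} _ (s≤s m≤n) = (λ ()) , λ _ → -≤- m≤n , -≤+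

  ⊑ᶻ-difference : ∀ {x y} → x ⊑ᶻ y → y - x ⊑ᶻ y
  ⊑ᶻ-difference {x} {y} (x⁺ , x⁻) =
    (λ 0≤y → let 0≤x , x≤y = x⁺ 0≤y in ℤ.i≤j⇒0≤j-i x≤y , ℤ.i≤j⇒i-k≤j x {{ℤ.nonNegative 0≤x}} ℤ.≤-refl) ,
    (λ y≤0 → let y≤x , x≤0 = x⁻ y≤0 in
       ℤ.i≤i+j y (- x) {{ℤ.nonNegative (ℤ.neg-mono-≤ x≤0)}} , ℤ.i≤j⇒i-j≤0 y≤x)

  ⊑ᶻ0⇒≡0 : ∀ {x} → x ⊑ᶻ 0ℤ → x ≡ 0ℤ
  ⊑ᶻ0⇒≡0 (x⁺ , _) = let 0≤x , x≤0 = x⁺ ℤ.≤-refl in ℤ.≤-antisym x≤0 0≤x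

  ⊑ᶻ1⇒0or1 : ∀ {x} → x ⊑ᶻ 1ℤ → x ≡ 0ℤ ⊎ x ≡ 1ℤ
  ⊑ᶻ1⇒0or1 {x} (x⁺ , _) = between (x⁺ (+≤+ z≤n))
    where
    between : 0ℤ ≤ x × x ≤ 1ℤ → x ≡ 0ℤ ⊎ x ≡ 1ℤ
    between (+≤+ {n = zero}      _ , _)          = inj₁ refl
    between (+≤+ {n = suc zero}  _ , _)          = inj₂ refl
    between (+≤+ {n = suc (suc _)} _ , +≤+ (s≤s ()))

  i-j+j≡i : ∀ i j → i - j + j ≡ i
  i-j+j≡i = solve-∀

  ∣∣-split-nonNeg : ∀ {x y} → 0ℤ ≤ x → x ≤ y → ∣ y ∣ ≡ ∣ y - x ∣ ℕ.+ ∣ x ∣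
  ∣∣-split-nonNeg {x} {y} 0≤x x≤y = ℤ.+-injective (begin
    + ∣ y ∣                  ≡⟨ ℤ.0≤i⇒+∣i∣≡i (ℤ.≤-trans 0≤x x≤y) ⟩
    y                        ≡⟨ i-j+j≡i y x ⟨
    (y - x) + x              ≡⟨ cong₂ _+_ (ℤ.0≤i⇒+∣i∣≡i (ℤ.i≤j⇒0≤j-i x≤y)) (ℤ.0≤i⇒+∣i∣≡i 0≤x) ⟨
    + ∣ y - x ∣ + + ∣ x ∣    ≡⟨ ℤ.pos-+ ∣ y - x ∣ ∣ x ∣ ⟨
    + (∣ y - x ∣ ℕ.+ ∣ x ∣)  ∎)
    where open ≡-Reasoning

  ∣∣-split : ∀ {x y} → x ⊑ᶻ y → ∣ y ∣ ≡ ∣ y - x ∣ ℕ.+ ∣ x ∣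
  ∣∣-split {x} {y} x⊑y with 0ℤ ℤ.≤? y
  ... | yes 0≤y = let 0≤x , x≤y = proj₁ x⊑y 0≤y in ∣∣-split-nonNeg 0≤x x≤y
  ... | no 0≰y = let 0≤-x , -x≤-y = proj₁ (neg-⊑ᶻ x⊑y) (ℤ.neg-mono-≤ (ℤ.<⇒≤ (ℤ.≰⇒> 0≰y))) in begin
    ∣ y ∣                        ≡⟨ ℤ.∣-i∣≡∣i∣ y ⟨
    ∣ - y ∣                      ≡⟨ ∣∣-split-nonNeg 0≤-x -x≤-y ⟩
    ∣ - y - - x ∣ ℕ.+ ∣ - x ∣    ≡⟨ cong₂ ℕ._+_ ∣-y--x∣≡∣y-x∣ (ℤ.∣-i∣≡∣i∣ x) ⟩
    ∣ y - x ∣ ℕ.+ ∣ x ∣          ∎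
    where
    open ≡-Reasoning
    ∣-y--x∣≡∣y-x∣ : ∣ - y - - x ∣ ≡ ∣ y - x ∣
    ∣-y--x∣≡∣y-x∣ = trans (cong ∣_∣ (sym (ℤ.neg-distrib-+ y (- x)))) (ℤ.∣-i∣≡∣i∣ (y - x))

  private
    sumFin-neg-* : ∀ {m} (a : Fin m → ℤ) (U : Fin m → ℕ) →
                   sumFin (λ c → - a c * + U c) ≡ - sumFin (λ c → a c * + U c)
    sumFin-neg-* a U =
      trans (sumFin-cong (λ c → sym (ℤ.neg-distribˡ-* (a c) (+ U c)))) (sumFin-neg (λ c → a c * + U c))

    term-between : ∀ a {u w} → u ℕ.≤ w → (0 ℕ.< w → 0ℤ ≤ a) → 0ℤ ≤ a * + u × a * + u ≤ a * + w
    term-between a {w = zero} z≤n _ = subst (0ℤ ≤_) (sym (ℤ.*-zeroʳ a)) ℤ.≤-refl , ℤ.≤-refl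
    term-between a {u} {suc w} u≤w 0≤a =
      subst (_≤ a * + u) (ℤ.*-zeroʳ a) (ℤ.*-monoˡ-≤-nonNeg a {{a-nonNeg}} (+≤+ z≤n)) ,
      ℤ.*-monoˡ-≤-nonNeg a {{a-nonNeg}} (+≤+ u≤w)
      where a-nonNeg = ℤ.nonNegative (0≤a (s≤s z≤n))

  module _ {m} {a : Fin m → ℤ} {W : Fin m → ℕ} {V : ℤ} {U : Fin m → ℕ}
           (a⊑V : ∀ c → 0 ℕ.< W c → a c ⊑ᶻ V) (∑aW≡V : sumFin (λ c → a c * + W c) ≡ V)
           (U≤W : ∀ c → U c ℕ.≤ W c) (0≤V : 0ℤ ≤ V) where

    private
      term : ∀ c → 0ℤ ≤ a c * + U c × a c * + U c ≤ a c * + W c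
      term c = term-between (a c) (U≤W c) (λ 0<W → proj₁ (proj₁ (a⊑V c 0<W) 0≤V))

    sub-combination-nonNeg : 0ℤ ≤ sumFin (λ c → a c * + U c) × sumFin (λ c → a c * + U c) ≤ V
    sub-combination-nonNeg =
      sumFin-nonNeg (proj₁ ∘ term) , subst (sumFin (λ c → a c * + U c) ≤_) ∑aW≡V (sumFin-mono-≤ (proj₂ ∘ term))

    sub-combination-nonNeg-≡0 : sumFin (λ c → a c * + U c) ≡ 0ℤ → ∀ c → a c * + U c ≡ 0ℤ
    sub-combination-nonNeg-≡0 = sumFin-nonNeg-≡0 (proj₁ ∘ term)

  module _ {m} {a : Fin m → ℤ} {W : Fin m → ℕ} {V : ℤ} {U : Fin m → ℕ}
           (a⊑V : ∀ c → 0 ℕ.< W c → a c ⊑ᶻ V) (∑aW≡V : sumFin (λ c → a c * + W c) ≡ V)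
           (U≤W : ∀ c → U c ℕ.≤ W c) where

    private
      S = sumFin (λ c → a c * + U c)

      -a⊑-V : ∀ c → 0 ℕ.< W c → - a c ⊑ᶻ - V
      -a⊑-V c = neg-⊑ᶻ ∘ a⊑V c

      ∑-aW≡-V : sumFin (λ c → - a c * + W c) ≡ - V
      ∑-aW≡-V = trans (sumFin-neg-* a W) (cong -_ ∑aW≡V)

      0≤-V : V ≤ 0ℤ → 0ℤ ≤ - V
      0≤-V = ℤ.neg-mono-≤

      product≢0 : ∀ {x u} → x ≢ 0ℤ → 0 ℕ.< u → x * + u ≢ 0ℤ
      product≢0 {x} x≢0 0<u x*u≡0 with ℤ.i*j≡0⇒i≡0∨j≡0 x x*u≡0
      ... | inj₁ x≡0 = x≢0 x≡0
      ... | inj₂ u≡0 = ℕ.<⇒≢ 0<u (sym (ℤ.+-injective u≡0))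

    sub-combination-⊑ᶻ : S ⊑ᶻ V
    sub-combination-⊑ᶻ = sub-combination-nonNeg a⊑V ∑aW≡V U≤W , nonPos
      where
      nonPos : V ≤ 0ℤ → V ≤ S × S ≤ 0ℤ
      nonPos V≤0 =
        let 0≤-S , -S≤-V = sub-combination-nonNeg -a⊑-V ∑-aW≡-V U≤W (0≤-V V≤0)
        in  ℤ.neg-cancel-≤ (subst (_≤ - V) (sumFin-neg-* a U) -S≤-V) ,
            ℤ.neg-cancel-≤ (subst (0ℤ ≤_) (sumFin-neg-* a U) 0≤-S)

    -- All terms of S share the sign of V, so S can only vanish if each term does.
    sub-combination-≢0 : ∀ c₀ → 0 ℕ.< U c₀ → a c₀ ≢ 0ℤ → S ≢ 0ℤ
    sub-combination-≢0 c₀ 0<U a≢0 S≡0 with 0ℤ ℤ.≤? V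
    ... | yes 0≤V = product≢0 a≢0 0<U (sub-combination-nonNeg-≡0 a⊑V ∑aW≡V U≤W 0≤V S≡0 c₀)
    ... | no 0≰V  = product≢0 (a≢0 ∘ ℤ.neg-injective) 0<U
                      (sub-combination-nonNeg-≡0 -a⊑-V ∑-aW≡-V U≤W (0≤-V (ℤ.<⇒≤ (ℤ.≰⇒> 0≰V)))
                         (trans (sumFin-neg-* a U) (cong -_ S≡0)) c₀)

module GraverBasisOfOnes where

  open import Data.Integer using (ℤ; +_; 0ℤ; 1ℤ; -1ℤ; _+_; _*_; -_; _-_; ∣_∣)
  open FiniteSums
  open ConformalOrder

  private
    module ℤGroup = GroupProperties (AbelianGroup.group ℤ.+-0-abelianGroup)

  δ : ∀ {k} → Fin k → Fin k → ℕ
  δ zero    zero    = 1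
  δ zero    (suc _) = 0
  δ (suc _) zero    = 0
  δ (suc a) (suc j) = δ a j

  δ-diag : ∀ {k} (a : Fin k) → δ a a ≡ 1
  δ-diag zero    = refl
  δ-diag (suc a) = δ-diag a

  δ-off : ∀ {k} {a j : Fin k} → a ≢ j → δ a j ≡ 0
  δ-off {a = zero}  {zero}  a≢j = ⊥-elim (a≢j refl)
  δ-off {a = zero}  {suc j} _   = refl
  δ-off {a = suc a} {zero}  _   = refl
  δ-off {a = suc a} {suc j} a≢j = δ-off (a≢j ∘ cong suc)

  sumFin-δ* : ∀ {k} a (f : Fin k → ℤ) → sumFin (λ j → + δ a j * f j) ≡ f a
  sumFin-δ* {suc k} zero f = begin
    1ℤ * f zero + sumFin (λ j → 0ℤ * f (suc j))  ≡⟨ cong₂ _+_ (ℤ.*-identityˡ (f zero))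
                                                            (sumFin-cong (λ j → ℤ.*-zeroˡ (f (suc j)))) ⟩
    f zero + sumFin (λ (_ : Fin k) → 0ℤ)         ≡⟨ cong (_+_ (f zero)) (sumFin-zero k) ⟩
    f zero + 0ℤ                                   ≡⟨ ℤ.+-identityʳ (f zero) ⟩
    f zero                                        ∎
    where open ≡-Reasoning
  sumFin-δ* {suc k} (suc a) f =
    trans (cong (_+ sumFin (λ j → + δ a j * f (suc j))) (ℤ.*-zeroˡ (f zero)))
          (trans (ℤ.+-identityˡ _) (sumFin-δ* a (f ∘ suc)))

  sumFinℕ-δ : ∀ {k} (a : Fin k) → sumFinℕ (δ a) ≡ 1
  sumFinℕ-δ a = ℤ.+-injective (begin
    + sumFinℕ (δ a)              ≡⟨ +-sumFinℕ (δ a) ⟩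
    sumFin (λ j → + δ a j)       ≡⟨ sumFin-cong (λ j → ℤ.*-identityʳ (+ δ a j)) ⟨
    sumFin (λ j → + δ a j * 1ℤ)  ≡⟨ sumFin-δ* a (λ _ → 1ℤ) ⟩
    1ℤ                           ∎)
    where open ≡-Reasoning

  sumFin-support₂ : ∀ {k} {f : Fin k → ℤ} {a b} → a ≢ b →
                    (∀ j → j ≢ a → j ≢ b → f j ≡ 0ℤ) → sumFin f ≡ f a + f b
  sumFin-support₂ {f = f} {a} {b} a≢b off = begin
    sumFin f
      ≡⟨ sumFin-cong expand ⟩
    sumFin (λ j → + δ a j * f a + + δ b j * f b)
      ≡⟨ sumFin-distrib-+ (λ j → + δ a j * f a) (λ j → + δ b j * f b) ⟩
    sumFin (λ j → + δ a j * f a) + sumFin (λ j → + δ b j * f b)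
      ≡⟨ cong₂ _+_ (sumFin-δ* a (λ _ → f a)) (sumFin-δ* b (λ _ → f b)) ⟩
    f a + f b ∎
    where
    open ≡-Reasoning
    expand : ∀ j → f j ≡ + δ a j * f a + + δ b j * f b
    expand j with j Fin.≟ a | j Fin.≟ b
    ... | yes refl | yes refl = ⊥-elim (a≢b refl)
    ... | yes refl | no j≢b rewrite δ-diag j | δ-off (j≢b ∘ sym) =
      sym (trans (ℤ.+-identityʳ (1ℤ * f j)) (ℤ.*-identityˡ (f j)))
    ... | no j≢a | yes refl rewrite δ-diag j | δ-off (j≢a ∘ sym) =
      sym (trans (ℤ.+-identityˡ (1ℤ * f j)) (ℤ.*-identityˡ (f j)))
    ... | no j≢a | no j≢b rewrite δ-off (j≢a ∘ sym) | δ-off (j≢b ∘ sym) = off j j≢a j≢b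

  e : ∀ {k} → Fin k → Fin k → Fin k → ℤ
  e a b j = + δ a j - + δ b j

  module _ {k} {a b : Fin k} (a≢b : a ≢ b) where

    e-at-a : e a b a ≡ 1ℤ
    e-at-a rewrite δ-diag a | δ-off (a≢b ∘ sym) = refl

    e-at-b : e a b b ≡ -1ℤ
    e-at-b rewrite δ-diag b | δ-off a≢b = refl

    e-off : ∀ {j} → j ≢ a → j ≢ b → e a b j ≡ 0ℤ
    e-off j≢a j≢b rewrite δ-off (j≢a ∘ sym) | δ-off (j≢b ∘ sym) = refl

    sumFin-e : sumFin (e a b) ≡ 0ℤ
    sumFin-e = trans (sumFin-support₂ a≢b (λ _ → e-off)) (cong₂ _+_ e-at-a e-at-b)

    e-Graver : Graver (ones {k}) (e a b)
    e-Graver = (a , λ e≡0 → 1≢0 (trans (sym e-at-a) e≡0)) , inKer sumFin-e , minimal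
      where
      1≢0 : 1ℤ ≢ 0ℤ
      1≢0 ()

      inKer : ∀ {y : Fin k → ℤ} → sumFin y ≡ 0ℤ → MatKer (ones {k}) y
      inKer {y} ∑y≡0 _ = trans (sumFin-cong (λ j → ℤ.*-identityˡ (y j))) ∑y≡0

      minimal : ∀ y → NonZeroVec y → MatKer (ones {k}) y → y ⊑ e a b → ∀ j → y j ≡ e a b j
      minimal y (j₀ , yj₀≢0) y∈ker y⊑e = y≡e
        where
        y⊑ᶻe : ∀ j → y j ⊑ᶻ e a b j
        y⊑ᶻe j = ⊑-coordinate⇒⊑ᶻ (proj₁ (y⊑e j)) (proj₂ (y⊑e j))

        y-off : ∀ j → j ≢ a → j ≢ b → y j ≡ 0ℤ
        y-off j j≢a j≢b = ⊑ᶻ0⇒≡0 (subst (y j ⊑ᶻ_) (e-off j≢a j≢b) (y⊑ᶻe j))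

        ya+yb≡0 : y a + y b ≡ 0ℤ
        ya+yb≡0 = trans (sym (sumFin-support₂ a≢b y-off))
                        (trans (sumFin-cong (λ j → sym (ℤ.*-identityˡ (y j)))) (y∈ker zero))

        y≡ya*e : ∀ j → y j ≡ y a * e a b j
        y≡ya*e j with j Fin.≟ a | j Fin.≟ b
        ... | yes refl | _        = sym (trans (cong (y j *_) e-at-a) (ℤ.*-identityʳ (y j)))
        ... | no _     | yes refl = begin
          y j              ≡⟨ ℤGroup.inverseʳ-unique (y a) (y j) ya+yb≡0 ⟩
          - y a            ≡⟨ ℤ.-1*i≡-i (y a) ⟨
          -1ℤ * y a        ≡⟨ ℤ.*-comm -1ℤ (y a) ⟩
          y a * -1ℤ        ≡⟨ cong (y a *_) e-at-b ⟨
          y a * e a b j    ∎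
          where open ≡-Reasoning
        ... | no j≢a   | no j≢b   = trans (y-off j j≢a j≢b)
                                     (sym (trans (cong (y a *_) (e-off j≢a j≢b)) (ℤ.*-zeroʳ (y a))))

        y≡e : ∀ j → y j ≡ e a b j
        y≡e with ⊑ᶻ1⇒0or1 (subst (y a ⊑ᶻ_) e-at-a (y⊑ᶻe a))
        ... | inj₁ ya≡0 = ⊥-elim (yj₀≢0 (trans (y≡ya*e j₀) (trans (cong (_* e a b j₀) ya≡0) (ℤ.*-zeroˡ (e a b j₀)))))
        ... | inj₂ ya≡1 = λ j → trans (y≡ya*e j) (trans (cong (_* e a b j) ya≡1) (ℤ.*-identityˡ (e a b j)))

  norm1-e : ∀ {k} {a b : Fin k} → a ≢ b → norm1 (e a b) ≡ 2
  norm1-e {a = a} {b} a≢b = ℤ.+-injective (begin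
    + norm1 (e a b)                ≡⟨ +-sumFinℕ (λ j → ∣ e a b j ∣) ⟩
    sumFin (λ j → + ∣ e a b j ∣)   ≡⟨ sumFin-support₂ a≢b (λ j j≢a j≢b → cong (λ x → + ∣ x ∣) (e-off a≢b j≢a j≢b)) ⟩
    + ∣ e a b a ∣ + + ∣ e a b b ∣  ≡⟨ cong₂ (λ x y → + ∣ x ∣ + + ∣ y ∣) (e-at-a a≢b) (e-at-b a≢b) ⟩
    + 2                            ∎)
    where open ≡-Reasoning

module Decomposition where

  open import Data.Integer using (ℤ; +_; 0ℤ; _+_; _*_; -_; _-_; ∣_∣; _<_; +≤+; -≤+)
  open FiniteSums
  open ConformalOrder
  open GraverBasisOfOnes

  positive-entry : ∀ {k} {v : Fin k → ℤ} → sumFin v ≡ 0ℤ → ¬ (∀ j → v j ≡ 0ℤ) → ∃ λ a → 0ℤ < v a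
  positive-entry {v = v} ∑v≡0 v≢0 with Fin.any? (λ a → 0ℤ ℤ.<? v a)
  ... | yes a = a
  ... | no ∄a = ⊥-elim (v≢0 λ j → ℤ.neg-injective (-v≡0 j))
    where
    -v≡0 : ∀ j → - v j ≡ 0ℤ
    -v≡0 = sumFin-nonNeg-≡0 (λ j → ℤ.neg-mono-≤ (ℤ.≮⇒≥ (λ 0<vj → ∄a (j , 0<vj))))
                            (trans (sumFin-neg v) (cong -_ ∑v≡0))

  negative-entry : ∀ {k} {v : Fin k → ℤ} → sumFin v ≡ 0ℤ → ¬ (∀ j → v j ≡ 0ℤ) → ∃ λ b → v b < 0ℤ
  negative-entry {v = v} ∑v≡0 v≢0 =
    let b , 0<-vb = positive-entry (trans (sumFin-neg v) (cong -_ ∑v≡0))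
                                   (λ -v≡0 → v≢0 (λ j → ℤ.neg-injective (-v≡0 j)))
    in b , ℤ.neg-cancel-< 0<-vb

  module _ {k} {v : Fin k → ℤ} {a b : Fin k} (0<va : 0ℤ < v a) (vb<0 : v b < 0ℤ) where

    positive≢negative : a ≢ b
    positive≢negative refl = ℤ.<-asym 0<va vb<0

    e⊑ᶻ : ∀ j → e a b j ⊑ᶻ v j
    e⊑ᶻ j with j Fin.≟ a | j Fin.≟ b
    ... | yes refl | yes refl = ⊥-elim (positive≢negative refl)
    ... | yes refl | no _ rewrite e-at-a positive≢negative =
      (λ _ → +≤+ z≤n , ℤ.i<j⇒suc[i]≤j 0<va) , (λ va≤0 → ⊥-elim (ℤ.<⇒≱ 0<va va≤0))
    ... | no _ | yes refl rewrite e-at-b positive≢negative =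
      (λ 0≤vb → ⊥-elim (ℤ.<⇒≱ vb<0 0≤vb)) , (λ _ → ℤ.i<j⇒i≤pred[j] vb<0 , -≤+)
    ... | no j≢a | no j≢b rewrite e-off positive≢negative j≢a j≢b = 0⊑ᶻ (v j)

  norm1-split : ∀ {k} {x v : Fin k → ℤ} → (∀ j → x j ⊑ᶻ v j) →
                norm1 v ≡ norm1 (λ j → v j - x j) ℕ.+ norm1 x
  norm1-split {x = x} {v} x⊑v =
    trans (sumFinℕ-cong (λ j → ∣∣-split (x⊑v j))) (sumFinℕ-distrib-+ (λ j → ∣ v j - x j ∣) (λ j → ∣ x j ∣))

  record ConformalDecomposition {t m} (cols : Fin m → Fin t → ℤ) (v : Fin t → ℤ) : Set where
    field
      weight      : Fin m → ℕ
      conformal   : ∀ c → 0 ℕ.< weight c → ∀ j → cols c j ⊑ᶻ v j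
      combination : ∀ j → sumFin (λ c → cols c j * + weight c) ≡ v j
      norm1-≡     : norm1 v ≡ 2 ℕ.* sumFinℕ weight

  module _ {t m} (cols : Fin m → Fin t → ℤ)
           (e∈cols : ∀ {a b : Fin t} → a ≢ b → ∃ λ c → ∀ j → cols c j ≡ e a b j) where

    zero-decomposition : ∀ {v} → (∀ j → v j ≡ 0ℤ) → ConformalDecomposition cols v
    zero-decomposition {v} v≡0 = record
      { weight      = λ _ → 0
      ; conformal   = λ _ ()
      ; combination = λ j → begin
          sumFin (λ c → cols c j * 0ℤ)  ≡⟨ sumFin-cong (λ c → ℤ.*-zeroʳ (cols c j)) ⟩
          sumFin (λ (_ : Fin m) → 0ℤ)   ≡⟨ sumFin-zero m ⟩
          0ℤ                            ≡⟨ v≡0 j ⟨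
          v j                           ∎
      ; norm1-≡     = begin
          norm1 v                       ≡⟨ sumFinℕ-cong (λ j → cong ∣_∣ (v≡0 j)) ⟩
          sumFinℕ (λ (_ : Fin t) → 0)   ≡⟨ sumFinℕ-zero t ⟩
          0                             ≡⟨ cong (2 ℕ.*_) (sumFinℕ-zero m) ⟨
          2 ℕ.* sumFinℕ (λ (_ : Fin m) → 0) ∎
      }
      where open ≡-Reasoning

    add-column : ∀ {v a b} (0<va : 0ℤ < v a) (vb<0 : v b < 0ℤ) →
                 ConformalDecomposition cols (λ j → v j - e a b j) → ConformalDecomposition cols v
    add-column {v} {a} {b} 0<va vb<0 rest = record
      { weight      = weight
      ; conformal   = conformal
      ; combination = combination
      ; norm1-≡     = norm1-≡
      }
      where
      module R = ConformalDecomposition rest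
      a≢b = positive≢negative {v = v} 0<va vb<0
      c = proj₁ (e∈cols a≢b)
      col-c≡e = proj₂ (e∈cols a≢b)
      e⊑v : ∀ j → e a b j ⊑ᶻ v j
      e⊑v = e⊑ᶻ {v = v} 0<va vb<0

      weight : Fin m → ℕ
      weight c′ = R.weight c′ ℕ.+ δ c c′

      conformal : ∀ c′ → 0 ℕ.< weight c′ → ∀ j → cols c′ j ⊑ᶻ v j
      conformal c′ 0<w j with c Fin.≟ c′
      ... | yes refl = subst (_⊑ᶻ v j) (sym (col-c≡e j)) (e⊑v j)
      ... | no c≢c′  = ⊑ᶻ-trans (R.conformal c′ 0<w′ j) (⊑ᶻ-difference (e⊑v j))
        where
        0<w′ : 0 ℕ.< R.weight c′
        0<w′ = subst (0 ℕ.<_) (trans (cong (R.weight c′ ℕ.+_) (δ-off c≢c′)) (ℕ.+-identityʳ _)) 0<w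

      combination : ∀ j → sumFin (λ c′ → cols c′ j * + weight c′) ≡ v j
      combination j = begin
        sumFin (λ c′ → cols c′ j * + weight c′)
          ≡⟨ sumFin-cong (λ c′ → trans (cong (cols c′ j *_) (ℤ.pos-+ (R.weight c′) (δ c c′)))
                                        (ℤ.*-distribˡ-+ (cols c′ j) _ _)) ⟩
        sumFin (λ c′ → cols c′ j * + R.weight c′ + cols c′ j * + δ c c′)
          ≡⟨ sumFin-distrib-+ (λ c′ → cols c′ j * + R.weight c′) (λ c′ → cols c′ j * + δ c c′) ⟩
        sumFin (λ c′ → cols c′ j * + R.weight c′) + sumFin (λ c′ → cols c′ j * + δ c c′)
          ≡⟨ cong₂ _+_ (R.combination j) (trans (sumFin-cong (λ c′ → ℤ.*-comm (cols c′ j) _))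
                                                (trans (sumFin-δ* c (λ c′ → cols c′ j)) (col-c≡e j))) ⟩
        v j - e a b j + e a b j
          ≡⟨ i-j+j≡i (v j) (e a b j) ⟩
        v j ∎
        where open ≡-Reasoning

      norm1-≡ : norm1 v ≡ 2 ℕ.* sumFinℕ weight
      norm1-≡ = begin
        norm1 v
          ≡⟨ norm1-split e⊑v ⟩
        norm1 (λ j → v j - e a b j) ℕ.+ norm1 (e a b)
          ≡⟨ cong₂ ℕ._+_ R.norm1-≡ (norm1-e a≢b) ⟩
        2 ℕ.* sumFinℕ R.weight ℕ.+ 2 ℕ.* 1
          ≡⟨ ℕ.*-distribˡ-+ 2 (sumFinℕ R.weight) 1 ⟨
        2 ℕ.* (sumFinℕ R.weight ℕ.+ 1)
          ≡⟨ cong (λ s → 2 ℕ.* (sumFinℕ R.weight ℕ.+ s)) (sumFinℕ-δ c) ⟨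
        2 ℕ.* (sumFinℕ R.weight ℕ.+ sumFinℕ (δ c))
          ≡⟨ cong (2 ℕ.*_) (sumFinℕ-distrib-+ R.weight (δ c)) ⟨
        2 ℕ.* sumFinℕ weight ∎
        where open ≡-Reasoning

    decompose : ∀ N {v} → norm1 v ℕ.≤ N → sumFin v ≡ 0ℤ → ConformalDecomposition cols v
    decompose zero {v} ‖v‖≤0 _ =
      zero-decomposition (λ j → ℤ.∣i∣≡0⇒i≡0 (ℕ.n≤0⇒n≡0 (ℕ.≤-trans (term≤sumFinℕ (λ j → ∣ v j ∣) j) ‖v‖≤0)))
    decompose (suc N) {v} ‖v‖≤1+N ∑v≡0 with Fin.all? (λ j → v j ℤ.≟ 0ℤ)
    ... | yes v≡0 = zero-decomposition v≡0
    ... | no v≢0 with positive-entry ∑v≡0 v≢0 | negative-entry ∑v≡0 v≢0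
    ... | a , 0<va | b , vb<0 = add-column 0<va vb<0 (decompose N ‖v′‖≤N ∑v′≡0)
      where
      a≢b = positive≢negative {v = v} 0<va vb<0
      v′ : Fin t → ℤ
      v′ j = v j - e a b j
      ‖v′‖≤N : norm1 v′ ℕ.≤ N
      ‖v′‖≤N = ℕ.<⇒≤ (ℕ.s≤s⁻¹ (begin
        suc (suc (norm1 v′))       ≡⟨ ℕ.+-comm (norm1 v′) 2 ⟨
        norm1 v′ ℕ.+ 2             ≡⟨ cong (norm1 v′ ℕ.+_) (norm1-e a≢b) ⟨
        norm1 v′ ℕ.+ norm1 (e a b) ≡⟨ norm1-split (e⊑ᶻ {v = v} 0<va vb<0) ⟨
        norm1 v                    ≤⟨ ‖v‖≤1+N ⟩
        suc N                      ∎))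
        where open ℕ.≤-Reasoning
      ∑v′≡0 : sumFin v′ ≡ 0ℤ
      ∑v′≡0 = begin
        sumFin v′                          ≡⟨ sumFin-distrib-+ v (λ j → - e a b j) ⟩
        sumFin v + sumFin (λ j → - e a b j) ≡⟨ cong₂ _+_ ∑v≡0 (sumFin-neg (e a b)) ⟩
        0ℤ - sumFin (e a b)                ≡⟨ cong (λ s → 0ℤ - s) (sumFin-e a≢b) ⟩
        0ℤ                                 ∎
        where open ≡-Reasoning

module NFoldRows where

  open import Data.Integer using (ℤ; +_; 0ℤ; _+_; _*_)
  open FiniteSums
  open GraverBasisOfOnes

  brick-sum : ∀ {n t} → (Fin n × Fin t → ℤ) → Fin n → ℤ
  brick-sum z i = sumFin (λ j → z (i , j))

  module _ {r t n} (D : Fin r → Fin t → ℤ) (z : Fin n × Fin t → ℤ) where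

    D-row : Fin r → ℤ
    D-row k = sumFin (λ i → sumFin (λ j → D k j * z (i , j)))

    applyEn-↑ˡ : ∀ k → applyEn D z (k ↑ˡ n) ≡ D-row k
    applyEn-↑ˡ k = sumFin-cong (λ i → sumFin-cong (λ j → cong (_* z (i , j)) En-↑ˡ))
      where
      En-↑ˡ : ∀ {i j} → En D (k ↑ˡ n) (i , j) ≡ D k j
      En-↑ˡ rewrite Fin.splitAt-↑ˡ r k n = refl

    applyEn-↑ʳ : ∀ i′ → applyEn D z (r ↑ʳ i′) ≡ brick-sum z i′
    applyEn-↑ʳ i′ = begin
      applyEn D z (r ↑ʳ i′)
        ≡⟨ sumFin-cong (λ i → sumFin-cong (λ j → cong (_* z (i , j)) En-↑ʳ)) ⟩
      sumFin (λ i → sumFin (λ j → + δ i′ i * z (i , j)))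
        ≡⟨ sumFin-cong (λ i → sumFin-*ˡ (+ δ i′ i) (λ j → z (i , j))) ⟩
      sumFin (λ i → + δ i′ i * brick-sum z i)
        ≡⟨ sumFin-δ* i′ (brick-sum z) ⟩
      brick-sum z i′ ∎
      where
      open ≡-Reasoning
      En-↑ʳ : ∀ {i j} → En D (r ↑ʳ i′) (i , j) ≡ + δ i′ i
      En-↑ʳ {i} rewrite Fin.splitAt-↑ʳ r n i′ with i′ Fin.≟ i
      ... | yes refl = cong +_ (sym (δ-diag i′))
      ... | no i′≢i  = cong +_ (sym (δ-off i′≢i))

    KerEn⇒D-row≡0 : KerEn D z → ∀ k → D-row k ≡ 0ℤ
    KerEn⇒D-row≡0 Ez≡0 k = trans (sym (applyEn-↑ˡ k)) (Ez≡0 (k ↑ˡ n))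

    KerEn⇒brick-sum≡0 : KerEn D z → ∀ i → brick-sum z i ≡ 0ℤ
    KerEn⇒brick-sum≡0 Ez≡0 i = trans (sym (applyEn-↑ʳ i)) (Ez≡0 (r ↑ʳ i))

    D-row≡0∧brick-sum≡0⇒KerEn : (∀ k → D-row k ≡ 0ℤ) → (∀ i → brick-sum z i ≡ 0ℤ) → KerEn D z
    D-row≡0∧brick-sum≡0⇒KerEn D-row≡0 brick-sum≡0 k =
      subst (λ k → applyEn D z k ≡ 0ℤ) (Fin.join-splitAt r n k) (by-block (splitAt r k))
      where
      by-block : ∀ s → applyEn D z (Fin.join r n s) ≡ 0ℤ
      by-block (inj₁ k′) = trans (applyEn-↑ˡ k′) (D-row≡0 k′)
      by-block (inj₂ i)  = trans (applyEn-↑ʳ i) (brick-sum≡0 i)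

module BrickWeights where

  open import Data.Integer using (ℤ; +_; 0ℤ; _+_; _*_; -_; _-_; ∣_∣; _≤_)
  open FiniteSums
  open ConformalOrder
  open GraverBasisOfOnes
  open Decomposition
  open NFoldRows

  module _ {t m} (cols : Fin m → Fin t → ℤ) where

    combine : ∀ {n} → (Fin n → Fin m → ℕ) → Fin n × Fin t → ℤ
    combine U (i , j) = sumFin (λ c → cols c j * + U i c)

    brick-sum-combine : ∀ {n} → (∀ c → sumFin (cols c) ≡ 0ℤ) →
                        ∀ (U : Fin n → Fin m → ℕ) i → brick-sum (combine U) i ≡ 0ℤ
    brick-sum-combine ∑cols≡0 U i = begin
      sumFin (λ j → sumFin (λ c → cols c j * + U i c))  ≡⟨ sumFin-comm (λ j c → cols c j * + U i c) ⟩
      sumFin (λ c → sumFin (λ j → cols c j * + U i c))  ≡⟨ sumFin-cong (λ c → sumFin-*ʳ (+ U i c) (cols c)) ⟩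
      sumFin (λ c → sumFin (cols c) * + U i c)          ≡⟨ sumFin-cong (λ c → cong (_* + U i c) (∑cols≡0 c)) ⟩
      sumFin (λ c → 0ℤ * + U i c)                       ≡⟨ sumFin-cong (λ c → ℤ.*-zeroˡ (+ U i c)) ⟩
      sumFin (λ (_ : Fin m) → 0ℤ)                       ≡⟨ sumFin-zero m ⟩
      0ℤ                                                ∎
      where open ≡-Reasoning

    D-row-combine : ∀ {r n} (D : Fin r → Fin t → ℤ) (U : Fin n → Fin m → ℕ) k →
                    D-row D (combine U) k ≡ sumFin (λ c → DG D cols k c * + sumFinℕ (λ i → U i c))
    D-row-combine D U k = begin
      sumFin (λ i → sumFin (λ j → D k j * sumFin (λ c → cols c j * u i c)))
        ≡⟨ sumFin-cong (λ i → sumFin-cong (λ j → sym (sumFin-*ˡ (D k j) (λ c → cols c j * u i c)))) ⟩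
      sumFin (λ i → sumFin (λ j → sumFin (λ c → D k j * (cols c j * u i c))))
        ≡⟨ sumFin-cong (λ i → sumFin-comm (λ j c → D k j * (cols c j * u i c))) ⟩
      sumFin (λ i → sumFin (λ c → sumFin (λ j → D k j * (cols c j * u i c))))
        ≡⟨ sumFin-cong (λ i → sumFin-cong (λ c → DG-entry i c)) ⟩
      sumFin (λ i → sumFin (λ c → DG D cols k c * u i c))
        ≡⟨ sumFin-comm (λ i c → DG D cols k c * u i c) ⟩
      sumFin (λ c → sumFin (λ i → DG D cols k c * u i c))
        ≡⟨ sumFin-cong (λ c → trans (sumFin-*ˡ (DG D cols k c) (λ i → u i c))
                                     (cong (DG D cols k c *_) (sym (+-sumFinℕ (λ i → U i c))))) ⟩
      sumFin (λ c → DG D cols k c * + sumFinℕ (λ i → U i c))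
        ∎
      where
      open ≡-Reasoning
      u : _ → Fin m → ℤ
      u i c = + U i c
      DG-entry : ∀ i c → sumFin (λ j → D k j * (cols c j * u i c)) ≡ DG D cols k c * u i c
      DG-entry i c = trans (sumFin-cong (λ j → sym (ℤ.*-assoc (D k j) (cols c j) (u i c))))
                           (sumFin-*ʳ (u i c) (λ j → D k j * cols c j))

  module _ {n t r m} (D : Fin r → Fin t → ℤ) {cols : Fin m → Fin t → ℤ} (cols-Graver : IsGraverColumns cols)
           {g : Fin n × Fin t → ℤ} (g-Graver : IsGraverElement (KerEn D) g) where

    private
      g∈ker : KerEn D g
      g∈ker = proj₁ (proj₂ g-Graver)

      col-Graver : ∀ c → Graver (ones {t}) (cols c)
      col-Graver = proj₁ cols-Graver

      ∑cols≡0 : ∀ c → sumFin (cols c) ≡ 0ℤ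
      ∑cols≡0 c = trans (sumFin-cong (λ j → sym (ℤ.*-identityˡ (cols c j)))) (proj₁ (proj₂ (col-Graver c)) zero)

      e∈cols : ∀ {a b : Fin t} → a ≢ b → ∃ λ c → ∀ j → cols c j ≡ e a b j
      e∈cols a≢b = proj₂ (proj₂ cols-Graver) _ (e-Graver a≢b)

      decomposition : ∀ i → ConformalDecomposition cols (λ j → g (i , j))
      decomposition i = decompose cols e∈cols _ ℕ.≤-refl (KerEn⇒brick-sum≡0 D g g∈ker i)

      module Dec i = ConformalDecomposition (decomposition i)

      W : Fin n → Fin m → ℕ
      W = Dec.weight

    Λ : Fin m → ℤ
    Λ c = + sumFinℕ (λ i → W i c)

    private
      combine-W : ∀ p → combine cols W p ≡ g p
      combine-W (i , j) = Dec.combination i j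

      module _ {U : Fin n → Fin m → ℕ} (U≤W : ∀ i c → U i c ℕ.≤ W i c) where

        combine-⊑ : combine cols U ⊑ g
        combine-⊑ (i , j) = ⊑ᶻ⇒⊑-coordinate
          (sub-combination-⊑ᶻ (λ c 0<W → Dec.conformal i c 0<W j) (Dec.combination i j) (U≤W i))

        combine-≢0 : ∀ i c → 0 ℕ.< U i c → NonZeroVec (combine cols U)
        combine-≢0 i c 0<U = let j , col≢0 = proj₁ (col-Graver c) in
          (i , j) , sub-combination-≢0 (λ c 0<W → Dec.conformal i c 0<W j) (Dec.combination i j) (U≤W i) c 0<U col≢0

        -- Otherwise the leftover weights W i - U i form a conformal combination of nonzero columns
        -- with a positive weight that sums to g - g = 0, which sub-combination-≢0 rules out.
        combine-rigid : (∀ p → combine cols U p ≡ g p) → ∀ i c → U i c ≡ W i c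
        combine-rigid GU≡g i c with U i c ℕ.≟ W i c
        ... | yes U≡W = U≡W
        ... | no U≢W  = ⊥-elim (sub-combination-≢0 (λ c 0<W → Dec.conformal i c 0<W j) (Dec.combination i j)
                           (λ c → ℕ.m∸n≤m (W i c) (U i c)) c
                           (ℕ.m<n⇒0<n∸m (ℕ.≤∧≢⇒< (U≤W i c) U≢W)) col≢0 leftover≡0)
          where
          j = proj₁ (proj₁ (col-Graver c))
          col≢0 = proj₂ (proj₁ (col-Graver c))
          +[w∸u]≡w-u : ∀ c → + (W i c ∸ U i c) ≡ + W i c - + U i c
          +[w∸u]≡w-u c = trans (sym (ℤ.≤-⊖ (U≤W i c))) (sym (ℤ.[+m]-[+n]≡m⊖n (W i c) (U i c)))
          leftover≡0 : sumFin (λ c → cols c j * + (W i c ∸ U i c)) ≡ 0ℤ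
          leftover≡0 = begin
            sumFin (λ c → cols c j * + (W i c ∸ U i c))
              ≡⟨ sumFin-cong (λ c → trans (cong (cols c j *_) (+[w∸u]≡w-u c))
                                           (ℤ.*-distribˡ-+ (cols c j) (+ W i c) (- + U i c))) ⟩
            sumFin (λ c → cols c j * + W i c + cols c j * - + U i c)
              ≡⟨ sumFin-distrib-+ (λ c → cols c j * + W i c) (λ c → cols c j * - + U i c) ⟩
            combine cols W (i , j) + sumFin (λ c → cols c j * - + U i c)
              ≡⟨ cong (_+_ (combine cols W (i , j)))
                      (trans (sumFin-cong (λ c → sym (ℤ.neg-distribʳ-* (cols c j) (+ U i c))))
                             (sumFin-neg (λ c → cols c j * + U i c))) ⟩
            combine cols W (i , j) - combine cols U (i , j)
              ≡⟨ cong₂ _-_ (combine-W (i , j)) (GU≡g (i , j)) ⟩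
            g (i , j) - g (i , j)
              ≡⟨ ℤ.+-inverseʳ (g (i , j)) ⟩
            0ℤ ∎
            where open ≡-Reasoning

      split-weights : ∀ {y} → y ⊑ Λ →
                      Σ (Fin n → Fin m → ℕ) λ Y → (∀ i c → Y i c ℕ.≤ W i c) × (∀ c → + sumFinℕ (λ i → Y i c) ≡ y c)
      split-weights {y} y⊑Λ = (λ i c → proj₁ (split c) i) , (λ i c → proj₁ (proj₂ (split c)) i) ,
                              (λ c → trans (cong +_ (proj₂ (proj₂ (split c)))) (ℤ.0≤i⇒+∣i∣≡i (0≤y c)))
        where
        split : ∀ c → ∃ λ u → (∀ i → u i ℕ.≤ W i c) × sumFinℕ u ≡ ∣ y c ∣
        split c = split-≤-sumFinℕ (λ i → W i c) (proj₂ (y⊑Λ c))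
        0≤y : ∀ c → 0ℤ ≤ y c
        0≤y c = proj₁ (proj₁ (⊑-coordinate⇒⊑ᶻ (proj₁ (y⊑Λ c)) (proj₂ (y⊑Λ c))) (ℤ.+≤+ z≤n))

    Λ∈ker : MatKer (DG D cols) Λ
    Λ∈ker k = begin
      sumFin (λ c → DG D cols k c * Λ c)
        ≡⟨ D-row-combine cols D W k ⟨
      D-row D (combine cols W) k
        ≡⟨ sumFin-cong (λ i → sumFin-cong (λ j → cong (D k j *_) (combine-W (i , j)))) ⟩
      D-row D g k
        ≡⟨ KerEn⇒D-row≡0 D g g∈ker k ⟩
      0ℤ ∎
      where open ≡-Reasoning

    Λ≢0 : NonZeroVec Λ
    Λ≢0 = c , λ Λc≡0 → ℕ.<⇒≢ (ℕ.<-≤-trans 0<W (term≤sumFinℕ (λ i → W i c) i₀)) (sym (ℤ.+-injective Λc≡0))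
      where
      i₀ = proj₁ (proj₁ (proj₁ g-Graver))
      j₀ = proj₂ (proj₁ (proj₁ g-Graver))
      W≢0 : ¬ (∀ c → W i₀ c ≡ 0)
      W≢0 W≡0 = proj₂ (proj₁ g-Graver) (begin
        g (i₀ , j₀)                          ≡⟨ combine-W (i₀ , j₀) ⟨
        sumFin (λ c → cols c j₀ * + W i₀ c)  ≡⟨ sumFin-cong (λ c → trans (cong (λ w → cols c j₀ * + w) (W≡0 c))
                                                                          (ℤ.*-zeroʳ (cols c j₀))) ⟩
        sumFin (λ (_ : Fin m) → 0ℤ)          ≡⟨ sumFin-zero m ⟩
        0ℤ                                   ∎)
        where open ≡-Reasoning
      c = proj₁ (∃-positive-term (W i₀) W≢0)
      0<W = proj₂ (∃-positive-term (W i₀) W≢0)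

    Λ-minimal : ∀ y → NonZeroVec y → MatKer (DG D cols) y → y ⊑ Λ → ∀ c → y c ≡ Λ c
    Λ-minimal y (c₀ , yc₀≢0) y∈ker y⊑Λ with split-weights y⊑Λ
    ... | Y , Y≤W , ∑Y≡y = λ c → trans (sym (∑Y≡y c)) (cong +_ (sumFinℕ-cong (λ i → Y≡W i c)))
      where
      GY∈ker : KerEn D (combine cols Y)
      GY∈ker = D-row≡0∧brick-sum≡0⇒KerEn D (combine cols Y)
        (λ k → trans (D-row-combine cols D Y k)
                     (trans (sumFin-cong (λ c → cong (DG D cols k c *_) (∑Y≡y c))) (y∈ker k)))
        (brick-sum-combine cols ∑cols≡0 Y)
      Y≢0 : ¬ (∀ i → Y i c₀ ≡ 0)
      Y≢0 Y≡0 = yc₀≢0 (trans (sym (∑Y≡y c₀)) (cong +_ (trans (sumFinℕ-cong Y≡0) (sumFinℕ-zero n))))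
      GY≢0 : NonZeroVec (combine cols Y)
      GY≢0 = let i₀ , 0<Y = ∃-positive-term (λ i → Y i c₀) Y≢0 in combine-≢0 Y≤W i₀ c₀ 0<Y
      Y≡W : ∀ i c → Y i c ≡ W i c
      Y≡W = combine-rigid Y≤W (proj₂ (proj₂ g-Graver) (combine cols Y) GY≢0 GY∈ker (combine-⊑ Y≤W))

    Λ-Graver : Graver (DG D cols) Λ
    Λ-Graver = Λ≢0 , Λ∈ker , Λ-minimal

    norm1-bricks≡2*norm1-Λ : sumFinℕ (λ i → norm1 (λ j → g (i , j))) ≡ 2 ℕ.* norm1 Λ
    norm1-bricks≡2*norm1-Λ = begin
      sumFinℕ (λ i → norm1 (λ j → g (i , j)))  ≡⟨ sumFinℕ-cong Dec.norm1-≡ ⟩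
      sumFinℕ (λ i → 2 ℕ.* sumFinℕ (W i))      ≡⟨ sumFinℕ-*ˡ 2 (λ i → sumFinℕ (W i)) ⟩
      2 ℕ.* sumFinℕ (λ i → sumFinℕ (W i))      ≡⟨ cong (2 ℕ.*_) (sumFinℕ-comm W) ⟩
      2 ℕ.* norm1 Λ                            ∎
      where open ≡-Reasoning

    norm1-bricks≤2gE : ∀ {gE} → IsGE D cols gE → sumFinℕ (λ i → norm1 (λ j → g (i , j))) ℕ.≤ 2 ℕ.* gE
    norm1-bricks≤2gE (Graver⇒≤gE , _) =
      ℕ.≤-trans (ℕ.≤-reflexive norm1-bricks≡2*norm1-Λ) (ℕ.*-monoʳ-≤ 2 (Graver⇒≤gE Λ Λ-Graver))

module PrefixSums where

  open import Data.Integer using (ℤ; +_; 0ℤ; _+_; -_; _-_; ∣_∣)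
  open FiniteSums

  -- Bricks and rows of D are read as ℕ-indexed sequences, padded with a default value beyond
  -- their length, so that partial sums and the walk can recurse on ℕ.
  extend : ∀ {k} {A : Set} → A → (Fin k → A) → ℕ → A
  extend {zero}  z f _       = z
  extend {suc k} z f zero    = f zero
  extend {suc k} z f (suc K) = extend z (f ∘ suc) K

  extend-toℕ : ∀ {k} {A : Set} (z : A) (f : Fin k → A) i → extend z f (toℕ i) ≡ f i
  extend-toℕ z f zero    = refl
  extend-toℕ z f (suc i) = extend-toℕ z (f ∘ suc) i

  extend-fromℕ< : ∀ {k} {A : Set} (z : A) (f : Fin k → A) {K} .(K<k : K ℕ.< k) → extend z f K ≡ f (Fin.fromℕ< K<k)
  extend-fromℕ< {suc k} z f {zero}  _   = refl
  extend-fromℕ< {suc k} z f {suc K} K<k = extend-fromℕ< z (f ∘ suc) (ℕ.s<s⁻¹ K<k)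

  ∣extend∣≤ : ∀ {k} {f : Fin k → ℤ} {B} → (∀ i → ∣ f i ∣ ℕ.≤ B) → ∀ K → ∣ extend 0ℤ f K ∣ ℕ.≤ B
  ∣extend∣≤ {zero}          f≤B K       = z≤n
  ∣extend∣≤ {suc k}         f≤B zero    = f≤B zero
  ∣extend∣≤ {suc k} {f} {B} f≤B (suc K) = ∣extend∣≤ {f = f ∘ suc} (f≤B ∘ suc) K

  prefix : (ℕ → ℤ) → ℕ → ℤ
  prefix f zero    = 0ℤ
  prefix f (suc K) = prefix f K + f K

  prefixℕ : (ℕ → ℕ) → ℕ → ℕ
  prefixℕ f zero    = 0
  prefixℕ f (suc K) = prefixℕ f K ℕ.+ f K

  private
    a+b-a≡b : ∀ a b → a + b - a ≡ b
    a+b-a≡b = solve-∀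

    a-b+c≡[a+c]-b : ∀ a b c → a - b + c ≡ (a + c) - b
    a-b+c≡[a+c]-b = solve-∀

    b-a≡-[a+[0-b]] : ∀ a b → b - a ≡ - (a + (0ℤ - b))
    b-a≡-[a+[0-b]] = solve-∀

    [a+b]+c≡b+[a+c] : ∀ a b c → a ℕ.+ b ℕ.+ c ≡ b ℕ.+ (a ℕ.+ c)
    [a+b]+c≡b+[a+c] = ℕ-Solver.solve-∀

  prefix-suc-shift : ∀ f K → prefix f (suc K) ≡ f 0 + prefix (f ∘ suc) K
  prefix-suc-shift f zero    = trans (ℤ.+-identityˡ (f 0)) (sym (ℤ.+-identityʳ (f 0)))
  prefix-suc-shift f (suc K) = trans (cong (_+ f (suc K)) (prefix-suc-shift f K)) (ℤ.+-assoc (f 0) _ _)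

  prefixℕ-suc-shift : ∀ f K → prefixℕ f (suc K) ≡ f 0 ℕ.+ prefixℕ (f ∘ suc) K
  prefixℕ-suc-shift f zero    = ℕ.+-comm 0 (f 0)
  prefixℕ-suc-shift f (suc K) = trans (cong (ℕ._+ f (suc K)) (prefixℕ-suc-shift f K)) (ℕ.+-assoc (f 0) _ _)

  sumFin∘toℕ≡prefix : ∀ k (f : ℕ → ℤ) → sumFin {k} (f ∘ toℕ) ≡ prefix f k
  sumFin∘toℕ≡prefix zero    f = refl
  sumFin∘toℕ≡prefix (suc k) f =
    trans (cong (_+_ (f 0)) (sumFin∘toℕ≡prefix k (f ∘ suc))) (sym (prefix-suc-shift f k))

  sumFinℕ∘toℕ≡prefixℕ : ∀ k (f : ℕ → ℕ) → sumFinℕ {k} (f ∘ toℕ) ≡ prefixℕ f k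
  sumFinℕ∘toℕ≡prefixℕ zero    f = refl
  sumFinℕ∘toℕ≡prefixℕ (suc k) f =
    trans (cong (f 0 ℕ.+_) (sumFinℕ∘toℕ≡prefixℕ k (f ∘ suc))) (sym (prefixℕ-suc-shift f k))

  prefixℕ-mono : ∀ f {K L} → K ℕ.≤ L → prefixℕ f K ℕ.≤ prefixℕ f L
  prefixℕ-mono f K≤L = go (ℕ.≤⇒≤′ K≤L)
    where
    go : ∀ {K L} → K ≤′ L → prefixℕ f K ℕ.≤ prefixℕ f L
    go ≤′-refl         = ℕ.≤-refl
    go (≤′-step K≤′L) = ℕ.≤-trans (go K≤′L) (ℕ.m≤m+n _ _)

  prefixℕ-*ˡ : ∀ c f K → prefixℕ (λ J → c ℕ.* f J) K ≡ c ℕ.* prefixℕ f K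
  prefixℕ-*ˡ c f zero    = sym (ℕ.*-zeroʳ c)
  prefixℕ-*ˡ c f (suc K) = trans (cong (ℕ._+ c ℕ.* f K) (prefixℕ-*ˡ c f K)) (sym (ℕ.*-distribˡ-+ c _ _))

  ∣prefix∣≤ : ∀ {F G} → (∀ J → ∣ F J ∣ ℕ.≤ G J) → ∀ K → ∣ prefix F K ∣ ℕ.≤ prefixℕ G K
  ∣prefix∣≤ F≤G zero    = z≤n
  ∣prefix∣≤ {F} F≤G (suc K) =
    ℕ.≤-trans (ℤ.∣i+j∣≤∣i∣+∣j∣ (prefix F K) (F K)) (ℕ.+-mono-≤ (∣prefix∣≤ F≤G K) (F≤G K))

  module _ (f : ℕ → ℤ) where

    private
      A = prefixℕ (∣_∣ ∘ f)

    prefix+∣segment∣≤ : ∀ {K L} → K ℕ.≤ L → A K ℕ.+ ∣ prefix f L - prefix f K ∣ ℕ.≤ A L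
    prefix+∣segment∣≤ K≤L = go (ℕ.≤⇒≤′ K≤L)
      where
      go : ∀ {K L} → K ≤′ L → A K ℕ.+ ∣ prefix f L - prefix f K ∣ ℕ.≤ A L
      go {K} ≤′-refl =
        ℕ.≤-reflexive (trans (cong (λ s → A K ℕ.+ ∣ s ∣) (ℤ.+-inverseʳ (prefix f K))) (ℕ.+-identityʳ (A K)))
      go {K} {suc L} (≤′-step K≤′L) = begin
        A K ℕ.+ ∣ prefix f L + f L - prefix f K ∣
          ≡⟨ cong (λ s → A K ℕ.+ ∣ s ∣) (a-b+c≡[a+c]-b (prefix f L) (prefix f K) (f L)) ⟨
        A K ℕ.+ ∣ prefix f L - prefix f K + f L ∣
          ≤⟨ ℕ.+-monoʳ-≤ (A K) (ℤ.∣i+j∣≤∣i∣+∣j∣ (prefix f L - prefix f K) (f L)) ⟩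
        A K ℕ.+ (∣ prefix f L - prefix f K ∣ ℕ.+ ∣ f L ∣)
          ≡⟨ ℕ.+-assoc (A K) (∣ prefix f L - prefix f K ∣) (∣ f L ∣) ⟨
        A K ℕ.+ ∣ prefix f L - prefix f K ∣ ℕ.+ ∣ f L ∣
          ≤⟨ ℕ.+-monoˡ-≤ (∣ f L ∣) (go K≤′L) ⟩
        A L ℕ.+ ∣ f L ∣
          ∎
        where open ℕ.≤-Reasoning

    module _ {t} (∑f≡0 : prefix f t ≡ 0ℤ) where

      -- A segment of a zero-sum sequence is minus the sum of its complement.
      2*∣segment∣≤ : ∀ {K L} → K ℕ.≤ L → L ℕ.≤ t → 2 ℕ.* ∣ prefix f L - prefix f K ∣ ℕ.≤ A t
      2*∣segment∣≤ {K} {L} K≤L L≤t = begin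
        2 ℕ.* ∣ seg ∣                      ≡⟨ cong (∣ seg ∣ ℕ.+_) (ℕ.+-identityʳ ∣ seg ∣) ⟩
        ∣ seg ∣ ℕ.+ ∣ seg ∣                ≤⟨ ℕ.+-monoˡ-≤ ∣ seg ∣ ∣seg∣≤ ⟩
        A K ℕ.+ ∣ rest ∣ ℕ.+ ∣ seg ∣       ≡⟨ [a+b]+c≡b+[a+c] (A K) ∣ rest ∣ ∣ seg ∣ ⟩
        ∣ rest ∣ ℕ.+ (A K ℕ.+ ∣ seg ∣)     ≤⟨ ℕ.+-monoʳ-≤ ∣ rest ∣ (prefix+∣segment∣≤ K≤L) ⟩
        ∣ rest ∣ ℕ.+ A L                   ≡⟨ ℕ.+-comm ∣ rest ∣ (A L) ⟩
        A L ℕ.+ ∣ rest ∣                   ≤⟨ prefix+∣segment∣≤ L≤t ⟩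
        A t                                ∎
        where
        open ℕ.≤-Reasoning
        seg rest : ℤ
        seg  = prefix f L - prefix f K
        rest = prefix f t - prefix f L
        seg≡-[K+rest] : seg ≡ - (prefix f K + rest)
        seg≡-[K+rest] = trans (b-a≡-[a+[0-b]] (prefix f K) (prefix f L))
                              (cong (λ s → - (prefix f K + (s - prefix f L))) (sym ∑f≡0))
        ∣seg∣≤ : ∣ seg ∣ ℕ.≤ A K ℕ.+ ∣ rest ∣
        ∣seg∣≤ = begin
          ∣ seg ∣                                    ≡⟨ cong ∣_∣ seg≡-[K+rest] ⟩
          ∣ - (prefix f K + rest) ∣                  ≡⟨ ℤ.∣-i∣≡∣i∣ (prefix f K + rest) ⟩
          ∣ prefix f K + rest ∣                      ≤⟨ ℤ.∣i+j∣≤∣i∣+∣j∣ (prefix f K) rest ⟩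
          ∣ prefix f K ∣ ℕ.+ ∣ rest ∣                ≤⟨ ℕ.+-monoˡ-≤ ∣ rest ∣ (∣prefix∣≤ (λ _ → ℕ.≤-refl) K) ⟩
          A K ℕ.+ ∣ rest ∣                           ∎

      2*∣term∣≤ : ∀ {K} → K ℕ.< t → 2 ℕ.* ∣ f K ∣ ℕ.≤ A t
      2*∣term∣≤ {K} K<t =
        subst (λ s → 2 ℕ.* ∣ s ∣ ℕ.≤ A t) (a+b-a≡b (prefix f K) (f K)) (2*∣segment∣≤ (ℕ.n≤1+n K) K<t)

      2*∣prefix∣≤ : ∀ {L} → L ℕ.≤ t → 2 ℕ.* ∣ prefix f L ∣ ℕ.≤ A t
      2*∣prefix∣≤ {L} L≤t =
        subst (λ s → 2 ℕ.* ∣ s ∣ ℕ.≤ A t) (ℤ.+-identityʳ (prefix f L)) (2*∣segment∣≤ z≤n L≤t)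

module AugmentingWalk {n′ t′ r : ℕ} (D : Fin r → Fin (suc t′) → ℤ) (l u x : Fin (suc n′) × Fin (suc t′) → ℤ)
  (α gE : ℕ) (g : Fin (suc n′) × Fin (suc t′) → ℤ)
  (brick-sum≡0 : ∀ i → NFoldRows.brick-sum g i ≡ 0ℤ)
  (D-row≡0 : ∀ k → NFoldRows.D-row D g k ≡ 0ℤ)
  (x+αg-in-bounds : ∀ i j → AugGraph.BoundOK D l u x α gE i j (g (i , j)))
  (‖g‖≤2gE : sumFinℕ (λ i → norm1 (λ j → g (i , j))) ℕ.≤ 2 ℕ.* gE) where

  open import Data.Integer using (ℤ; +_; -[1+_]; 0ℤ; _+_; _*_; ∣_∣; +≤+; -≤+; -≤-)
  open FiniteSums
  open NFoldRows
  open PrefixSums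
  open AugGraph D l u x α gE

  private
    n t : ℕ
    n = suc n′
    t = suc t′

    ∣i∣≤n⇒InRange : ∀ {i n} → ∣ i ∣ ℕ.≤ n → InRange (+ n) i
    ∣i∣≤n⇒InRange {+ _}       {zero}  ∣i∣≤n       = +≤+ z≤n , +≤+ ∣i∣≤n
    ∣i∣≤n⇒InRange {+ _}       {suc n} ∣i∣≤n       = -≤+ , +≤+ ∣i∣≤n
    ∣i∣≤n⇒InRange { -[1+ _ ]} {suc n} (s≤s ∣i∣≤n) = -≤- ∣i∣≤n , -≤+

  brick : Fin n → Fin t → ℤ
  brick i j = g (i , j)

  g-seq : ℕ → ℕ → ℤ
  g-seq I = extend 0ℤ (extend (λ _ → 0ℤ) brick I)

  D-seq : Fin r → ℕ → ℤ
  D-seq k = extend 0ℤ (D k)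

  Dg-seq : Fin r → ℕ → ℕ → ℤ
  Dg-seq k I J = D-seq k J * g-seq I J

  σ : ℕ → ℕ → Fin r → ℤ
  σ I K k = prefix (λ I′ → prefix (Dg-seq k I′) t) I + prefix (Dg-seq k I) (suc K)

  vertex : ∀ I K → .(I ℕ.< n) → .(K ℕ.< t) → Vtx
  vertex I K I<n K<t = node (fromℕ< I<n) (fromℕ< K<t) (g-seq I K) (prefix (g-seq I) (suc K)) (σ I K)

  g-seq-toℕ : ∀ i j → g-seq (toℕ i) (toℕ j) ≡ g (i , j)
  g-seq-toℕ i j = trans (cong (λ h → extend 0ℤ h (toℕ j)) (extend-toℕ (λ _ → 0ℤ) brick i))
                        (extend-toℕ 0ℤ (brick i) j)

  g-seq-fromℕ< : ∀ {I K} .(I<n : I ℕ.< n) .(K<t : K ℕ.< t) → g-seq I K ≡ g (fromℕ< I<n , fromℕ< K<t)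
  g-seq-fromℕ< {I} {K} I<n K<t = trans (cong (λ h → extend 0ℤ h K) (extend-fromℕ< (λ _ → 0ℤ) brick I<n))
                                       (extend-fromℕ< 0ℤ (brick (fromℕ< I<n)) K<t)

  D-seq-fromℕ< : ∀ k {K} .(K<t : K ℕ.< t) → D-seq k K ≡ D k (fromℕ< K<t)
  D-seq-fromℕ< k = extend-fromℕ< 0ℤ (D k)

  g-seq-sum≡0 : ∀ {I} → I ℕ.< n → prefix (g-seq I) t ≡ 0ℤ
  g-seq-sum≡0 {I} I<n = begin
    prefix (g-seq I) t                        ≡⟨ sumFin∘toℕ≡prefix t (g-seq I) ⟨
    sumFin (λ (j : Fin t) → g-seq I (toℕ j))  ≡⟨ sumFin-cong (λ j → trans (g-seq-fromℕ< I<n (Fin.toℕ<n j))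
                                                                          (cong (brick i) (Fin.fromℕ<-toℕ j _))) ⟩
    brick-sum g i                             ≡⟨ brick-sum≡0 i ⟩
    0ℤ                                        ∎
    where
    open ≡-Reasoning
    i = fromℕ< I<n

  Dg-seq-sum≡0 : ∀ k → σ n′ t′ k ≡ 0ℤ
  Dg-seq-sum≡0 k = begin
    prefix (λ I → prefix (Dg-seq k I) t) n
      ≡⟨ sumFin∘toℕ≡prefix n (λ I → prefix (Dg-seq k I) t) ⟨
    sumFin (λ (i : Fin n) → prefix (Dg-seq k (toℕ i)) t)
      ≡⟨ sumFin-cong (λ (i : Fin n) → sumFin∘toℕ≡prefix t (Dg-seq k (toℕ i))) ⟨
    sumFin (λ (i : Fin n) → sumFin (λ (j : Fin t) → D-seq k (toℕ j) * g-seq (toℕ i) (toℕ j)))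
      ≡⟨ sumFin-cong (λ i → sumFin-cong (λ j → cong₂ _*_ (extend-toℕ 0ℤ (D k) j) (g-seq-toℕ i j))) ⟩
    D-row D g k
      ≡⟨ D-row≡0 k ⟩
    0ℤ ∎
    where open ≡-Reasoning

  brick-mass : ℕ → ℕ → ℕ
  brick-mass I = prefixℕ (∣_∣ ∘ g-seq I)

  mass-before : ℕ → ℕ
  mass-before = prefixℕ (λ I → brick-mass I t)

  total-mass≤2gE : mass-before n ℕ.≤ 2 ℕ.* gE
  total-mass≤2gE = ℕ.≤-trans (ℕ.≤-reflexive total-mass≡‖g‖) ‖g‖≤2gE
    where
    open ≡-Reasoning
    total-mass≡‖g‖ : mass-before n ≡ sumFinℕ (λ i → norm1 (brick i))
    total-mass≡‖g‖ = begin
      mass-before n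
        ≡⟨ sumFinℕ∘toℕ≡prefixℕ n (λ I → brick-mass I t) ⟨
      sumFinℕ (λ (i : Fin n) → brick-mass (toℕ i) t)
        ≡⟨ sumFinℕ-cong (λ (i : Fin n) → sumFinℕ∘toℕ≡prefixℕ t (∣_∣ ∘ g-seq (toℕ i))) ⟨
      sumFinℕ (λ (i : Fin n) → sumFinℕ (λ (j : Fin t) → ∣ g-seq (toℕ i) (toℕ j) ∣))
        ≡⟨ sumFinℕ-cong (λ i → sumFinℕ-cong (λ j → cong ∣_∣ (g-seq-toℕ i j))) ⟩
      sumFinℕ (λ i → norm1 (brick i)) ∎

  brick-mass≤total : ∀ {I} → I ℕ.< n → brick-mass I t ℕ.≤ mass-before n
  brick-mass≤total {I} I<n =
    ℕ.≤-trans (ℕ.m≤n+m (brick-mass I t) (mass-before I)) (prefixℕ-mono (λ I → brick-mass I t) I<n)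

  private
    halve : ∀ {a} → 2 ℕ.* a ℕ.≤ mass-before n → a ℕ.≤ gE
    halve 2a≤total = ℕ.*-cancelˡ-≤ 2 (ℕ.≤-trans 2a≤total total-mass≤2gE)

  ∣g-seq∣≤gE : ∀ {I K} → I ℕ.< n → K ℕ.< t → ∣ g-seq I K ∣ ℕ.≤ gE
  ∣g-seq∣≤gE {I} I<n K<t =
    halve (ℕ.≤-trans (2*∣term∣≤ (g-seq I) (g-seq-sum≡0 I<n) K<t) (brick-mass≤total I<n))

  ∣prefix-g-seq∣≤gE : ∀ {I K} → I ℕ.< n → K ℕ.< t → ∣ prefix (g-seq I) (suc K) ∣ ℕ.≤ gE
  ∣prefix-g-seq∣≤gE {I} I<n K<t =
    halve (ℕ.≤-trans (2*∣prefix∣≤ (g-seq I) (g-seq-sum≡0 I<n) K<t) (brick-mass≤total I<n))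

  ∣D-seq∣≤Δ : ∀ k J → ∣ D-seq k J ∣ ℕ.≤ Δ
  ∣D-seq∣≤Δ k = ∣extend∣≤ (λ j → ℕ.≤-trans (maxFin-≥ (λ j → ∣ D k j ∣) j)
                                 (ℕ.≤-trans (maxFin-≥ (λ k → maxFin (λ j → ∣ D k j ∣)) k) (ℕ.n≤1+n _)))

  ∣prefix-Dg-seq∣≤ : ∀ k I K → ∣ prefix (Dg-seq k I) K ∣ ℕ.≤ Δ ℕ.* brick-mass I K
  ∣prefix-Dg-seq∣≤ k I K = ℕ.≤-trans (∣prefix∣≤ term≤ K) (ℕ.≤-reflexive (prefixℕ-*ˡ Δ (∣_∣ ∘ g-seq I) K))
    where
    term≤ : ∀ J → ∣ D-seq k J * g-seq I J ∣ ℕ.≤ Δ ℕ.* ∣ g-seq I J ∣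
    term≤ J = ℕ.≤-trans (ℕ.≤-reflexive (ℤ.abs-* (D-seq k J) (g-seq I J))) (ℕ.*-monoˡ-≤ ∣ g-seq I J ∣ (∣D-seq∣≤Δ k J))

  ∣σ∣≤2ΔgE : ∀ {I K} → I ℕ.< n → K ℕ.< t → ∀ k → ∣ σ I K k ∣ ℕ.≤ 2 ℕ.* Δ ℕ.* gE
  ∣σ∣≤2ΔgE {I} {K} I<n K<t k = begin
    ∣ earlier + current ∣
      ≤⟨ ℤ.∣i+j∣≤∣i∣+∣j∣ earlier current ⟩
    ∣ earlier ∣ ℕ.+ ∣ current ∣
      ≤⟨ ℕ.+-mono-≤ ∣earlier∣≤ (∣prefix-Dg-seq∣≤ k I (suc K)) ⟩
    Δ ℕ.* mass-before I ℕ.+ Δ ℕ.* brick-mass I (suc K)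
      ≡⟨ ℕ.*-distribˡ-+ Δ (mass-before I) (brick-mass I (suc K)) ⟨
    Δ ℕ.* (mass-before I ℕ.+ brick-mass I (suc K))
      ≤⟨ ℕ.*-monoʳ-≤ Δ (ℕ.+-monoʳ-≤ (mass-before I) (prefixℕ-mono (∣_∣ ∘ g-seq I) K<t)) ⟩
    Δ ℕ.* mass-before (suc I)
      ≤⟨ ℕ.*-monoʳ-≤ Δ (ℕ.≤-trans (prefixℕ-mono (λ I → brick-mass I t) I<n) total-mass≤2gE) ⟩
    Δ ℕ.* (2 ℕ.* gE)
      ≡⟨ ℕ.*-assoc Δ 2 gE ⟨
    Δ ℕ.* 2 ℕ.* gE
      ≡⟨ cong (ℕ._* gE) (ℕ.*-comm Δ 2) ⟩
    2 ℕ.* Δ ℕ.* gE ∎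
    where
    open ℕ.≤-Reasoning
    earlier = prefix (λ I′ → prefix (Dg-seq k I′) t) I
    current = prefix (Dg-seq k I) (suc K)
    ∣earlier∣≤ : ∣ earlier ∣ ℕ.≤ Δ ℕ.* mass-before I
    ∣earlier∣≤ = ℕ.≤-trans (∣prefix∣≤ (λ I′ → ∣prefix-Dg-seq∣≤ k I′ t) I)
                           (ℕ.≤-reflexive (prefixℕ-*ˡ Δ (λ I′ → brick-mass I′ t) I))

  vertex-InGraph : ∀ {I K} (I<n : I ℕ.< n) (K<t : K ℕ.< t) → InGraph (vertex I K I<n K<t)
  vertex-InGraph I<n K<t =
    ∣i∣≤n⇒InRange (∣g-seq∣≤gE I<n K<t) ,
    ∣i∣≤n⇒InRange (∣prefix-g-seq∣≤gE I<n K<t) ,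
    λ k → ∣i∣≤n⇒InRange (∣σ∣≤2ΔgE I<n K<t k)

  vertex-BoundOK : ∀ {I K} .(I<n : I ℕ.< n) .(K<t : K ℕ.< t) → BoundOK (fromℕ< I<n) (fromℕ< K<t) (g-seq I K)
  vertex-BoundOK I<n K<t rewrite g-seq-fromℕ< I<n K<t = x+αg-in-bounds (fromℕ< I<n) (fromℕ< K<t)

  private
    edge-S′ : ∀ {i j h β σ} → β ≡ h → toℕ i ≡ 0 → toℕ j ≡ 0 → InGraph (node i j h β σ) → BoundOK i j h →
              (∀ k → σ k ≡ 0ℤ + D k j * h) → Edge S (node i j h β σ)
    edge-S′ refl = edge-S

    edge-b′ : ∀ {i i′ j j′ h β σ h′ β′ σ′} → β ≡ 0ℤ → β′ ≡ h′ →
              suc (toℕ j) ≡ t → suc (toℕ i) ≡ toℕ i′ → toℕ j′ ≡ 0 →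
              InGraph (node i j h β σ) → InGraph (node i′ j′ h′ β′ σ′) → BoundOK i′ j′ h′ →
              (∀ k → σ′ k ≡ σ k + D k j′ * h′) → Edge (node i j h β σ) (node i′ j′ h′ β′ σ′)
    edge-b′ refl refl = edge-b

    edge-T′ : ∀ {i j h β σ} → β ≡ 0ℤ → suc (toℕ i) ≡ n → suc (toℕ j) ≡ t → (∀ k → σ k ≡ 0ℤ) →
              InGraph (node i j h β σ) → Edge (node i j h β σ) T
    edge-T′ refl = edge-T

  -- Abstract: unfolding the bound proofs inside these edges while unifying walks exhausts memory.
  abstract
    S→first : (0<n : 0 ℕ.< n) (0<t : 0 ℕ.< t) → Edge S (vertex 0 0 0<n 0<t)
    S→first 0<n 0<t = edge-S′ (ℤ.+-identityˡ (g-seq 0 0)) refl refl (vertex-InGraph 0<n 0<t) (vertex-BoundOK 0<n 0<t)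
      (λ k → cong (_+_ 0ℤ) (trans (ℤ.+-identityˡ (Dg-seq k 0 0)) (cong (_* g-seq 0 0) (D-seq-fromℕ< k 0<t))))

    along-brick : ∀ {I K} (I<n : I ℕ.< n) (K<t : K ℕ.< t) (1+K<t : suc K ℕ.< t) →
                  Edge (vertex I K I<n K<t) (vertex I (suc K) I<n 1+K<t)
    along-brick {I} {K} I<n K<t 1+K<t =
      edge-a (trans (cong suc (Fin.toℕ-fromℕ< K<t)) (sym (Fin.toℕ-fromℕ< 1+K<t)))
        (vertex-InGraph I<n K<t) (vertex-InGraph I<n 1+K<t) (vertex-BoundOK I<n 1+K<t) refl
        (λ k → trans (sym (ℤ.+-assoc (prefix (λ I′ → prefix (Dg-seq k I′) t) I) (prefix (Dg-seq k I) (suc K))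
                                    (Dg-seq k I (suc K))))
                     (cong (_+_ (σ I K k)) (cong (_* g-seq I (suc K)) (D-seq-fromℕ< k 1+K<t))))

    next-brick : ∀ {I} (I<n : I ℕ.< n) (1+I<n : suc I ℕ.< n) (0<t : 0 ℕ.< t) →
                 Edge (vertex I t′ I<n (ℕ.n<1+n t′)) (vertex (suc I) 0 1+I<n 0<t)
    next-brick {I} I<n 1+I<n 0<t =
      edge-b′ (g-seq-sum≡0 I<n) (ℤ.+-identityˡ (g-seq (suc I) 0)) (cong suc (Fin.toℕ-fromℕ< (ℕ.n<1+n t′)))
        (trans (cong suc (Fin.toℕ-fromℕ< I<n)) (sym (Fin.toℕ-fromℕ< 1+I<n))) refl
        (vertex-InGraph I<n (ℕ.n<1+n t′)) (vertex-InGraph 1+I<n 0<t) (vertex-BoundOK 1+I<n 0<t)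
        (λ k → cong (_+_ (σ I t′ k)) (trans (ℤ.+-identityˡ (Dg-seq k (suc I) 0))
                                            (cong (_* g-seq (suc I) 0) (D-seq-fromℕ< k 0<t))))

    last→T : Edge (vertex n′ t′ (ℕ.n<1+n n′) (ℕ.n<1+n t′)) T
    last→T = edge-T′ (g-seq-sum≡0 (ℕ.n<1+n n′)) (cong suc (Fin.toℕ-fromℕ< (ℕ.n<1+n n′)))
               (cong suc (Fin.toℕ-fromℕ< (ℕ.n<1+n t′))) Dg-seq-sum≡0 (vertex-InGraph (ℕ.n<1+n n′) (ℕ.n<1+n t′))

  infixl 5 _▷_
  _▷_ : ∀ {a b c} → Walk a b → Edge b c → Walk a c
  []       ▷ e = e ∷ []
  (e′ ∷ w) ▷ e = e′ ∷ (w ▷ e)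

  Visits-▷ : ∀ {P a b c} {w : Walk a b} {e : Edge b c} → Visits P w → Visits P (w ▷ e)
  Visits-▷ (here p)  = here p
  Visits-▷ (there v) = there (Visits-▷ v)

  Visits-▷-end : ∀ {P a b c} (w : Walk a b) {e : Edge b c} → P c → Visits P (w ▷ e)
  Visits-▷-end []       p = there (here p)
  Visits-▷-end (e′ ∷ w) p = there (Visits-▷-end w p)

  walk-to : ∀ I K (I<n : I ℕ.< n) (K<t : K ℕ.< t) → Walk S (vertex I K I<n K<t)
  walk-to I       (suc K) I<n K<t = walk-to I K I<n K<t′ ▷ along-brick I<n K<t′ K<t
    where K<t′ = ℕ.<-trans (ℕ.n<1+n K) K<t
  walk-to zero    zero    I<n K<t = S→first I<n K<t ∷ []
  walk-to (suc I) zero    I<n K<t = walk-to I t′ I<n′ (ℕ.n<1+n t′) ▷ next-brick I<n′ I<n K<t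
    where I<n′ = ℕ.<-trans (ℕ.n<1+n I) I<n

  At : Fin n → Fin t → Vtx → Set
  At i j v = ∃₂ λ β σ → v ≡ node i j (g (i , j)) β σ

  vertex-At : ∀ {i j I K} .(I<n : I ℕ.< n) .(K<t : K ℕ.< t) → toℕ i ≡ I → toℕ j ≡ K → At i j (vertex I K I<n K<t)
  vertex-At {i} {j} I<n K<t refl refl = β , σ (toℕ i) (toℕ j) ,
    trans (cong₂ (λ i′ j′ → node i′ j′ (g-seq (toℕ i) (toℕ j)) β (σ (toℕ i) (toℕ j)))
                 (Fin.fromℕ<-toℕ i I<n) (Fin.fromℕ<-toℕ j K<t))
          (cong (λ h → node i j h β (σ (toℕ i) (toℕ j))) (g-seq-toℕ i j))
    where β = prefix (g-seq (toℕ i)) (suc (toℕ j))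

  infix 4 _≤ₗₑₓ_
  _≤ₗₑₓ_ : ℕ × ℕ → ℕ × ℕ → Set
  (I , K) ≤ₗₑₓ (I′ , K′) = I ℕ.< I′ ⊎ (I ≡ I′ × K ℕ.≤ K′)

  walk-to-visits : ∀ I K (I<n : I ℕ.< n) (K<t : K ℕ.< t) i j → (toℕ i , toℕ j) ≤ₗₑₓ (I , K) →
                   Visits (At i j) (walk-to I K I<n K<t)
  walk-to-visits I (suc K) I<n K<t i j = by-position
    where
    K<t′ = ℕ.<-trans (ℕ.n<1+n K) K<t
    by-position : (toℕ i , toℕ j) ≤ₗₑₓ (I , suc K) → Visits (At i j) (walk-to I (suc K) I<n K<t)
    by-position (inj₁ i<I) = Visits-▷ (walk-to-visits I K I<n K<t′ i j (inj₁ i<I))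
    by-position (inj₂ (i≡I , j≤1+K)) with ℕ.m≤n⇒m<n∨m≡n j≤1+K
    ... | inj₁ j<1+K = Visits-▷ (walk-to-visits I K I<n K<t′ i j (inj₂ (i≡I , ℕ.s≤s⁻¹ j<1+K)))
    ... | inj₂ j≡1+K = Visits-▷-end (walk-to I K I<n K<t′) (vertex-At I<n K<t i≡I j≡1+K)
  walk-to-visits zero zero I<n K<t i j (inj₂ (i≡0 , j≤0)) =
    there (here (vertex-At I<n K<t i≡0 (ℕ.n≤0⇒n≡0 j≤0)))
  walk-to-visits (suc I) zero I<n K<t i j = by-position
    where
    I<n′ = ℕ.<-trans (ℕ.n<1+n I) I<n
    by-position : (toℕ i , toℕ j) ≤ₗₑₓ (suc I , zero) → Visits (At i j) (walk-to (suc I) zero I<n K<t)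
    by-position (inj₁ i<1+I) with ℕ.m≤n⇒m<n∨m≡n (ℕ.s≤s⁻¹ i<1+I)
    ... | inj₁ i<I = Visits-▷ (walk-to-visits I t′ I<n′ (ℕ.n<1+n t′) i j (inj₁ i<I))
    ... | inj₂ i≡I = Visits-▷ (walk-to-visits I t′ I<n′ (ℕ.n<1+n t′) i j (inj₂ (i≡I , ℕ.s≤s⁻¹ (Fin.toℕ<n j))))
    by-position (inj₂ (i≡1+I , j≤0)) =
      Visits-▷-end (walk-to I t′ I<n′ (ℕ.n<1+n t′)) (vertex-At I<n K<t i≡1+I (ℕ.n≤0⇒n≡0 j≤0))

  solution : IsSolution g
  solution = walk-to n′ t′ last-n last-t ▷ last→T , visits
    where
    last-n = ℕ.n<1+n n′
    last-t = ℕ.n<1+n t′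
    visits : ∀ i j → Visits (At i j) (walk-to n′ t′ last-n last-t ▷ last→T)
    visits i j with ℕ.m≤n⇒m<n∨m≡n (ℕ.s≤s⁻¹ (Fin.toℕ<n i))
    ... | inj₁ i<n′ = Visits-▷ (walk-to-visits n′ t′ last-n last-t i j (inj₁ i<n′))
    ... | inj₂ i≡n′ = Visits-▷ (walk-to-visits n′ t′ last-n last-t i j (inj₂ (i≡n′ , ℕ.s≤s⁻¹ (Fin.toℕ<n j))))

open NFoldRows
open BrickWeights

open import Data.Nat using (ℕ; _+_)
open import Data.Integer using (ℤ; +_; _≤_) renaming (_+_ to _+ℤ_; _*_ to _*ℤ_)
open import Data.Fin using (Fin)
open import Data.Product using (_×_)

lemma6 : ∀ {n t r : ℕ} (D : Fin r → Fin t → ℤ) (b : Fin (r + n) → ℤ)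
           (l u x : Fin n × Fin t → ℤ) →
           Feasible D b l u x →
           (α : ℕ) →
           (m : ℕ) (cols : Fin m → Fin t → ℤ) → IsGraverColumns cols →
           (gE : ℕ) → IsGE D cols gE →
           (g : Fin n × Fin t → ℤ) → IsGraverElement (KerEn D) g →
           (∀ p → (l p ≤ x p +ℤ + α *ℤ g p) × (x p +ℤ + α *ℤ g p ≤ u p)) →
           AugGraph.IsSolution D l u x α gE g
lemma6 {ℕ.zero} _ _ _ _ _ _ _ _ _ _ _ _ _ (((() , _) , _) , _) _
lemma6 {ℕ.suc _} {ℕ.zero} _ _ _ _ _ _ _ _ _ _ _ _ _ (((_ , ()) , _) , _) _
lemma6 {ℕ.suc _} {ℕ.suc _} D _ l u x _ α _ _ cols-Graver gE gE-max g g-Graver x+αg-in-bounds =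
  AugmentingWalk.solution D l u x α gE g
    (KerEn⇒brick-sum≡0 D g g∈ker) (KerEn⇒D-row≡0 D g g∈ker) (λ i j → x+αg-in-bounds (i , j))
    (norm1-bricks≤2gE D cols-Graver g-Graver gE-max)
  where g∈ker = proj₁ (proj₂ g-Graver)
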